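{- Let $n\ge 2$ and let $\mathcal{A}_n$ denote the set of arc permutations in $S_n$. Then $$ \sum_{\pi\in\mathcal{A}_n} t^{\mathrm{inv}(\pi)} \mathbf{x}^{\mathrm{Des}(\pi)}= \prod_{i=1}^{n-1}(1+t^i x_i)+ \sum_{j=1}^{n-2}\left((t^{j(n-j)}x_j+t^{n-j-1}x_{j+1})\prod_{i=1}^{j-1}(1+t^i x_i)\prod_{i=j+2}^{n-1}(1+t^{n-i} x_i)\right). $$
   Context: An interval of $\mathbb{Z}_n$ is a set of the form $\{a,a+1,\dots,b\}$ or $\{b,b+1,\dots,n,1,2,\dots,a\}$ with $1\le a\le b\le n$. A permutation $\pi\in S_n$ is an arc permutation if for every $1\le j\le n$ the set $\{\pi(1),\dots,\pi(j)\}$ is an interval of $\mathbb{Z}_n$. For $\pi\in S_n$, $\mathrm{Des}(\pi)=\{i:\pi(i)>\pi(i+1)\}$, $\mathrm{inv}(\pi)=\#\{i<j:\pi(i)>\pi(j)\}$, and for a set $D=\{i_1,\dots,i_k\}$, $\mathbf{x}^D=x_{i_1}\cdots x_{i_k}$. -}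

module Defs where

open import Data.Nat using (ℕ; zero; suc; _∸_; _<ᵇ_; _≤ᵇ_; _≡ᵇ_)
import Data.Nat as ℕ
open import Data.Bool using (Bool; true; false; _∧_; _∨_; if_then_else_)
open import Data.List using (List; []; _∷_; map; concatMap; upTo; filter; take; foldr; length)
open import Data.Bool.Properties using (T?)
open import Algebra.Bundles using (CommutativeSemiring)
open import Level using (Level)

-- Finite combinatorics (values of permutations are 0,...,n-1, standing
-- for 1,...,n; positions are 1-based where they index variables x_i).

-- inclusive integer range [a, b] (empty if a > b)
range : ℕ → ℕ → List ℕ
range a b = map (a ℕ.+_) (upTo (suc b ∸ a))

allᵇ : {A : Set} → (A → Bool) → List A → Bool
allᵇ p = foldr (λ a r → p a ∧ r) true

anyᵇ : {A : Set} → (A → Bool) → List A → Bool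
anyᵇ p = foldr (λ a r → p a ∨ r) false

_∈ᵇ_ : ℕ → List ℕ → Bool
v ∈ᵇ w = anyᵇ (v ≡ᵇ_) w

_⇔ᵇ_ : Bool → Bool → Bool
true  ⇔ᵇ b = b
false ⇔ᵇ true = false
false ⇔ᵇ false = true

words : (n k : ℕ) → List (List ℕ)
words n zero    = [] ∷ []
words n (suc k) = concatMap (λ w → map (λ v → v ∷ w) (upTo n)) (words n k)

-- a word of length n over {0..n-1} is a permutation iff every value occurs
isPermᵇ : ℕ → List ℕ → Bool
isPermᵇ n w = allᵇ (λ v → v ∈ᵇ w) (upTo n)

sameSetᵇ : ℕ → List ℕ → (ℕ → Bool) → Bool
sameSetᵇ n S P = allᵇ (λ v → (v ∈ᵇ S) ⇔ᵇ P v) (upTo n)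

-- S is an interval of Z_n: S = {a,...,b} or S = {b,...,n-1,0,...,a}
-- for some 0 ≤ a ≤ b ≤ n-1
isIntervalᵇ : ℕ → List ℕ → Bool
isIntervalᵇ n S =
  anyᵇ (λ a → anyᵇ (λ b →
      (a ≤ᵇ b) ∧
      ( sameSetᵇ n S (λ v → (a ≤ᵇ v) ∧ (v ≤ᵇ b))
      ∨ sameSetᵇ n S (λ v → (b ≤ᵇ v) ∨ (v ≤ᵇ a))))
    (upTo n)) (upTo n)

isArcᵇ : ℕ → List ℕ → Bool
isArcᵇ n w = allᵇ (λ j → isIntervalᵇ n (take j w)) (range 1 n)

arcPerms : ℕ → List (List ℕ)
arcPerms n = filter (λ w → T? (isPermᵇ n w ∧ isArcᵇ n w)) (words n n)

countᵇ : (ℕ → Bool) → List ℕ → ℕ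
countᵇ p []      = 0
countᵇ p (a ∷ w) = (if p a then 1 else 0) ℕ.+ countᵇ p w

inv : List ℕ → ℕ
inv []      = 0
inv (a ∷ w) = countᵇ (_<ᵇ a) w ℕ.+ inv w

module Poly {c ℓ : Level} (R : CommutativeSemiring c ℓ) where
  open CommutativeSemiring R

  pow : Carrier → ℕ → Carrier
  pow y zero    = 1#
  pow y (suc k) = y * pow y k

  prodL : List Carrier → Carrier
  prodL = foldr _*_ 1#

  sumL : List Carrier → Carrier
  sumL = foldr _+_ 0#

  prodR : ℕ → ℕ → (ℕ → Carrier) → Carrier
  prodR a b f = prodL (map f (range a b))

  sumR : ℕ → ℕ → (ℕ → Carrier) → Carrier
  sumR a b f = sumL (map f (range a b))

  -- x^{Des(w)} where positions start at i (i = 1 for the whole word):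
  -- x_i is included iff w(i) > w(i+1)
  xDesFrom : (ℕ → Carrier) → ℕ → List ℕ → Carrier
  xDesFrom x i (a ∷ b ∷ w) = (if b <ᵇ a then x i else 1#) * xDesFrom x (suc i) (b ∷ w)
  xDesFrom x i _           = 1#

  xDes : (ℕ → Carrier) → List ℕ → Carrier
  xDes x w = xDesFrom x 1 w

  arcLHS : ℕ → Carrier → (ℕ → Carrier) → Carrier
  arcLHS n t x = sumL (map (λ w → pow t (inv w) * xDes x w) (arcPerms n))

  arcRHS : ℕ → Carrier → (ℕ → Carrier) → Carrier
  arcRHS n t x =
    prodR 1 (n ∸ 1) (λ i → 1# + pow t i * x i)
    + sumR 1 (n ∸ 2) (λ j →
        (pow t (j ℕ.* (n ∸ j)) * x j + pow t (n ∸ j ∸ 1) * x (suc j))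
        * prodR 1 (j ∸ 1) (λ i → 1# + pow t i * x i)
        * prodR (j ℕ.+ 2) (n ∸ 1) (λ i → 1# + pow t (n ∸ i) * x i))

module Submission where

-- Write permutations of {0,…,n-1} in one-line notation, N = n-1, and cut an arc permutation w at
-- whichever of the extreme values 0, N is placed second: w = u z d.  Before that point every prefix
-- misses 0 or N, so it is a range of consecutive integers (u is "prefix-ranged"); afterwards every
-- prefix contains 0 and N, so its complement, a suffix of d, is a range (d is "suffix-ranged").
-- Hence A_n is listed without repetition by 'arcList n': the prefix-ranged permutations, and for
-- 1 ≤ j ≤ n-2 the words u 0 d with u on {n-j,…,N} and u N d with u on {0,…,j-1}.  A prefix-ranged
-- word grows by appending a new maximum (weight unchanged) or a new minimum (weight times t^k x_k),
-- which produces the products of the theorem, and the weight of u z d factors through u and d.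

open import Defs
open import Level using (Level)
open import Algebra.Bundles using (CommutativeSemiring)
open import Data.Nat using (ℕ; zero; suc; _+_; _*_; _∸_; _≤_; _<_; _⊔_; z≤n; s≤s; _<ᵇ_; _≤ᵇ_; _≡ᵇ_)
import Data.Nat.Properties as ℕP
open import Data.Bool using (Bool; true; false; T; _∧_; _∨_; if_then_else_)
open import Data.Bool.Properties using (T-∧; T-∨; T?; T-≡)
open import Data.List using (List; []; _∷_; _++_; _∷ʳ_; map; concatMap; upTo; take; drop; length; initLast; _∷ʳ′_)
open import Data.Bool.ListAction using (any; all)
import Data.List.Properties as LP
open import Data.List.Membership.Propositional using (_∈_; _∉_; find; lose)
open import Data.List.Membership.Propositional.Properties
  using (∈-map⁺; ∈-map⁻; ∈-++⁺ˡ; ∈-++⁺ʳ; ∈-++⁻; ∈-upTo⁺; ∈-upTo⁻; ∈-∃++; ∈-filter⁺; ∈-filter⁻; ∈-concatMap⁺; ∈-concatMap⁻)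
open import Data.List.Relation.Unary.Any using (Any; here; there)
open import Data.List.Relation.Unary.Any.Properties using (any⁺; any⁻)
open import Data.List.Relation.Unary.All using (All; []; _∷_)
import Data.List.Relation.Unary.All as All
open import Data.List.Relation.Unary.All.Properties using (all⁺; all⁻)
open import Data.List.Relation.Unary.Unique.Propositional using (Unique; []; _∷_)
import Data.List.Relation.Unary.Unique.Propositional.Properties as Uniq
open import Data.Product using (∃-syntax; ∃₂; _×_; _,_; proj₁; proj₂)
open import Data.Sum using (_⊎_; inj₁; inj₂) renaming (map to ⊎-map)
open import Data.Empty using (⊥-elim)
open import Function using (_∘_; _⇔_; mk⇔; Equivalence)
open import Relation.Nullary using (yes; no)
open import Data.List.Membership.DecPropositional ℕP._≟_ using (_∈?_)
open import Relation.Binary.Definitions using (tri<; tri≈; tri>)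
open import Relation.Binary.PropositionalEquality using (_≡_; _≢_; refl; sym; trans; cong; cong₂; subst; subst₂; module ≡-Reasoning)
open import Data.List.Relation.Binary.Permutation.Propositional using (_↭_)
import Data.List.Relation.Binary.Permutation.Propositional.Properties as PermP
open import Data.List.Relation.Binary.BagAndSetEquality using (∼bag⇒↭)
open import Data.List.Membership.Propositional.Properties.WithK using (unique∧set⇒bag)
open import Data.Nat.Tactic.RingSolver using (solve-∀)

open Equivalence using (to; from)

anyᵇ⇔Any : {A : Set} (p : A → Bool) (xs : List A) → T (anyᵇ p xs) ⇔ Any (T ∘ p) xs
anyᵇ⇔Any p xs = mk⇔ (any⁻ p xs ∘ subst T anyᵇ≡any) (subst T (sym anyᵇ≡any) ∘ any⁺ p)
  where
  anyᵇ≡any : anyᵇ p xs ≡ any p xs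
  anyᵇ≡any = sym (LP.foldr-map _∨_ p false xs)

allᵇ⇔All : {A : Set} (p : A → Bool) (xs : List A) → T (allᵇ p xs) ⇔ All (T ∘ p) xs
allᵇ⇔All p xs = mk⇔ (all⁺ p xs ∘ subst T allᵇ≡all) (subst T (sym allᵇ≡all) ∘ all⁻ p)
  where
  allᵇ≡all : allᵇ p xs ≡ all p xs
  allᵇ≡all = sym (LP.foldr-map _∧_ p true xs)

∈ᵇ⇔∈ : (v : ℕ) (w : List ℕ) → T (v ∈ᵇ w) ⇔ v ∈ w
∈ᵇ⇔∈ v w = mk⇔ sound complete
  where
  sound : T (v ∈ᵇ w) → v ∈ w
  sound h with find (to (anyᵇ⇔Any (v ≡ᵇ_) w) h)
  ... | u , u∈w , v≡u rewrite ℕP.≡ᵇ⇒≡ v u v≡u = u∈w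
  complete : v ∈ w → T (v ∈ᵇ w)
  complete v∈w = from (anyᵇ⇔Any (v ≡ᵇ_) w) (lose v∈w (ℕP.≡⇒≡ᵇ v v refl))

allBelow⇔ : (n : ℕ) (p : ℕ → Bool) → T (allᵇ p (upTo n)) ⇔ (∀ v → v < n → T (p v))
allBelow⇔ n p = mk⇔
  (λ h v v<n → All.lookup (to (allᵇ⇔All p (upTo n)) h) (∈-upTo⁺ v<n))
  (λ h → from (allᵇ⇔All p (upTo n)) (All.tabulate (λ v∈ → h _ (∈-upTo⁻ v∈))))

anyBelow⇔ : (n : ℕ) (p : ℕ → Bool) → T (anyᵇ p (upTo n)) ⇔ (∃[ v ] (v < n × T (p v)))
anyBelow⇔ n p = mk⇔
  (λ h → let v , v∈ , pv = find (to (anyᵇ⇔Any p (upTo n)) h) in v , ∈-upTo⁻ v∈ , pv)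
  (λ (v , v<n , pv) → from (anyᵇ⇔Any p (upTo n)) (lose (∈-upTo⁺ v<n) pv))

⇔ᵇ⇔ : (a b : Bool) → T (a ⇔ᵇ b) ⇔ (T a ⇔ T b)
⇔ᵇ⇔ true  true  = mk⇔ (λ _ → mk⇔ (λ z → z) (λ z → z)) (λ _ → _)
⇔ᵇ⇔ true  false = mk⇔ (λ ()) (λ e → to e _)
⇔ᵇ⇔ false true  = mk⇔ (λ ()) (λ e → from e _)
⇔ᵇ⇔ false false = mk⇔ (λ _ → mk⇔ (λ z → z) (λ z → z)) (λ _ → _)

SameBelow : ℕ → List ℕ → (ℕ → Set) → Set
SameBelow n S Q = ∀ v → v < n → (v ∈ S → Q v) × (Q v → v ∈ S)

sameSetᵇ⇔ : (n : ℕ) (S : List ℕ) (p : ℕ → Bool) (Q : ℕ → Set) →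
  (∀ v → T (p v) ⇔ Q v) → T (sameSetᵇ n S p) ⇔ SameBelow n S Q
sameSetᵇ⇔ n S p Q p⇔Q = mk⇔
  (λ h v v<n → let e = to (⇔ᵇ⇔ (v ∈ᵇ S) (p v)) (to (allBelow⇔ n _) h v v<n) in
     (to (p⇔Q v) ∘ to e ∘ from (∈ᵇ⇔∈ v S)) , (to (∈ᵇ⇔∈ v S) ∘ from e ∘ from (p⇔Q v)))
  (λ h → from (allBelow⇔ n _) (λ v v<n → from (⇔ᵇ⇔ (v ∈ᵇ S) (p v))
     (mk⇔ (from (p⇔Q v) ∘ proj₁ (h v v<n) ∘ to (∈ᵇ⇔∈ v S)) (from (∈ᵇ⇔∈ v S) ∘ proj₂ (h v v<n) ∘ to (p⇔Q v)))))

Segment : ℕ → ℕ → ℕ → Set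
Segment a b v = a ≤ v × v ≤ b

WrapSegment : ℕ → ℕ → ℕ → Set
WrapSegment a b v = b ≤ v ⊎ v ≤ a

IsInterval : ℕ → List ℕ → Set
IsInterval n S = ∃₂ λ a b → a < n × b < n × a ≤ b ×
  (SameBelow n S (Segment a b) ⊎ SameBelow n S (WrapSegment a b))

isIntervalᵇ⇔ : (n : ℕ) (S : List ℕ) → T (isIntervalᵇ n S) ⇔ IsInterval n S
isIntervalᵇ⇔ n S = mk⇔ sound complete
  where
  ≤ᵇ⇔ : ∀ a v → T (a ≤ᵇ v) ⇔ (a ≤ v)
  ≤ᵇ⇔ a v = mk⇔ (ℕP.≤ᵇ⇒≤ a v) ℕP.≤⇒≤ᵇ
  segment⇔ : ∀ a b v → T ((a ≤ᵇ v) ∧ (v ≤ᵇ b)) ⇔ Segment a b v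
  segment⇔ a b v = mk⇔ (λ h → let l , r = to T-∧ h in to (≤ᵇ⇔ a v) l , to (≤ᵇ⇔ v b) r)
                        (λ (l , r) → from T-∧ (from (≤ᵇ⇔ a v) l , from (≤ᵇ⇔ v b) r))
  wrap⇔ : ∀ a b v → T ((b ≤ᵇ v) ∨ (v ≤ᵇ a)) ⇔ WrapSegment a b v
  wrap⇔ a b v = mk⇔ (λ h → ⊎-map (to (≤ᵇ⇔ b v)) (to (≤ᵇ⇔ v a)) (to T-∨ h))
                     (λ h → from T-∨ (⊎-map (from (≤ᵇ⇔ b v)) (from (≤ᵇ⇔ v a)) h))
  shape⇔ : ∀ a b → T (sameSetᵇ n S (λ v → (a ≤ᵇ v) ∧ (v ≤ᵇ b)) ∨ sameSetᵇ n S (λ v → (b ≤ᵇ v) ∨ (v ≤ᵇ a)))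
                   ⇔ (SameBelow n S (Segment a b) ⊎ SameBelow n S (WrapSegment a b))
  shape⇔ a b = mk⇔
    (λ h → ⊎-map (to (sameSetᵇ⇔ n S _ _ (segment⇔ a b))) (to (sameSetᵇ⇔ n S _ _ (wrap⇔ a b))) (to T-∨ h))
    (λ h → from T-∨ (⊎-map (from (sameSetᵇ⇔ n S _ _ (segment⇔ a b))) (from (sameSetᵇ⇔ n S _ _ (wrap⇔ a b))) h))
  sound : T (isIntervalᵇ n S) → IsInterval n S
  sound h with to (anyBelow⇔ n _) h
  ... | a , a<n , h′ with to (anyBelow⇔ n _) h′
  ... | b , b<n , h″ = let a≤b , sh = to T-∧ h″ in
        a , b , a<n , b<n , to (≤ᵇ⇔ a b) a≤b , to (shape⇔ a b) sh
  complete : IsInterval n S → T (isIntervalᵇ n S)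
  complete (a , b , a<n , b<n , a≤b , sh) =
    from (anyBelow⇔ n _) (a , a<n , from (anyBelow⇔ n _) (b , b<n , from T-∧ (from (≤ᵇ⇔ a b) a≤b , from (shape⇔ a b) sh)))

-- Splitting a duplicate-free concatenation; the library only provides the converse 'Uniq.++⁺'.
unique-++⁻ : {A : Set} (p : List A) {q : List A} → Unique (p ++ q) → Unique p × Unique q × (∀ {x} → x ∈ p → x ∉ q)
unique-++⁻ []      u          = [] , u , λ ()
unique-++⁻ (a ∷ p) (a∉ ∷ u) with unique-++⁻ p u
... | up , uq , disjoint =
  All.tabulate (λ x∈p → All.lookup a∉ (∈-++⁺ˡ x∈p)) ∷ up , uq ,
  λ { (here refl) x∈q → All.lookup a∉ (∈-++⁺ʳ p x∈q) refl ; (there x∈p) → disjoint x∈p }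

unique-++⁺ : {A : Set} {p q : List A} → Unique p → Unique q → (∀ {x} → x ∈ p → x ∉ q) → Unique (p ++ q)
unique-++⁺ up uq disjoint = Uniq.++⁺ up uq (λ (x∈p , x∈q) → disjoint x∈p x∈q)

unique-∷ : {A : Set} {x : A} {p : List A} → x ∉ p → Unique p → Unique (x ∷ p)
unique-∷ x∉p up = All.tabulate (λ y∈p x≡y → x∉p (subst (_∈ _) (sym x≡y) y∈p)) ∷ up

unique-concatMap : {A B : Set} (F : B → List A) (key : A → B) (bs : List B) → Unique bs →
  (∀ {b} → b ∈ bs → Unique (F b)) → (∀ {b a} → b ∈ bs → a ∈ F b → key a ≡ b) → Unique (concatMap F bs)
unique-concatMap F key []       _          _  _  = []
unique-concatMap F key (b ∷ bs) (b∉bs ∷ u) uF kF =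
  unique-++⁺ (uF (here refl)) (unique-concatMap F key bs u (λ b∈ → uF (there b∈)) (λ b∈ → kF (there b∈))) disjoint
  where
  disjoint : ∀ {a} → a ∈ F b → a ∉ concatMap F bs
  disjoint a∈Fb a∈rest with find (∈-concatMap⁻ F a∈rest)
  ... | b′ , b′∈bs , a∈Fb′ = All.lookup b∉bs b′∈bs (trans (sym (kF (here refl) a∈Fb)) (kF (there b′∈bs) a∈Fb′))

∈-concatMap-intro : {A B : Set} (F : A → List B) {a : A} {as : List A} {b : B} → a ∈ as → b ∈ F a → b ∈ concatMap F as
∈-concatMap-intro F a∈ b∈ = ∈-concatMap⁺ F (lose a∈ b∈)

unique⊆⇒length≤ : (V w : List ℕ) → Unique V → (∀ {v} → v ∈ V → v ∈ w) → length V ≤ length w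
unique⊆⇒length≤ []      w _            _  = z≤n
unique⊆⇒length≤ (b ∷ V) w (b∉V ∷ uV) V⊆w with ∈-∃++ (V⊆w (here refl))
... | w₁ , w₂ , refl rewrite LP.length-++-sucʳ w₁ b w₂ = s≤s (unique⊆⇒length≤ V (w₁ ++ w₂) uV V⊆rest)
  where
  V⊆rest : ∀ {v} → v ∈ V → v ∈ w₁ ++ w₂
  V⊆rest {v} v∈V with ∈-++⁻ w₁ (V⊆w (there v∈V))
  ... | inj₁ v∈w₁        = ∈-++⁺ˡ v∈w₁
  ... | inj₂ (here refl) = ⊥-elim (All.lookup b∉V v∈V refl)
  ... | inj₂ (there v∈w₂) = ∈-++⁺ʳ w₁ v∈w₂

delete-covered : ∀ x w V → Unique V → (∀ {v} → v ∈ V → v ∈ x ∷ w) →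
  ∃[ V′ ] (Unique V′ × (∀ {v} → v ∈ V′ → v ∈ w) × length V ≤ suc (length V′))
delete-covered x w V uV V⊆ with x ∈? V
... | no x∉V = V , uV , V⊆w , ℕP.n≤1+n _
  where
  V⊆w : ∀ {v} → v ∈ V → v ∈ w
  V⊆w v∈V with V⊆ v∈V
  ... | here refl = ⊥-elim (x∉V v∈V)
  ... | there v∈w = v∈w
... | yes x∈V with ∈-∃++ x∈V
...   | V₁ , V₂ , refl with unique-++⁻ V₁ uV
...     | u₁ , x∉V₂ ∷ u₂ , disjoint =
  V₁ ++ V₂ , unique-++⁺ u₁ u₂ (λ v∈₁ v∈₂ → disjoint v∈₁ (there v∈₂)) , V′⊆w , ℕP.≤-reflexive (LP.length-++-sucʳ V₁ x V₂)
  where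
  V′⊆w : ∀ {v} → v ∈ V₁ ++ V₂ → v ∈ w
  V′⊆w v∈V′ with ∈-++⁻ V₁ v∈V′
  ... | inj₁ v∈V₁ with V⊆ (∈-++⁺ˡ v∈V₁)
  ...   | here refl = ⊥-elim (disjoint v∈V₁ (here refl))
  ...   | there v∈w = v∈w
  V′⊆w v∈V′ | inj₂ v∈V₂ with V⊆ (∈-++⁺ʳ V₁ (there v∈V₂))
  ...   | here refl = ⊥-elim (All.lookup x∉V₂ v∈V₂ refl)
  ...   | there v∈w = v∈w

covering⇒unique : (w V : List ℕ) → Unique V → (∀ {v} → v ∈ V → v ∈ w) → length w ≤ length V → Unique w
covering⇒unique []      V _  _   _   = []
covering⇒unique (x ∷ w) V uV V⊆ len with delete-covered x w V uV V⊆
... | V′ , uV′ , V′⊆w , |V|≤ = unique-∷ x∉w (covering⇒unique w V′ uV′ V′⊆w (ℕP.≤-pred (ℕP.≤-trans len |V|≤)))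
  where
  -- were x repeated, V would fit into w, which is shorter than V
  x∉w : x ∉ w
  x∉w x∈w = ℕP.<-irrefl refl (ℕP.≤-trans len (unique⊆⇒length≤ V w uV V⊆w))
    where
    V⊆w : ∀ {v} → v ∈ V → v ∈ w
    V⊆w v∈V with V⊆ v∈V
    ... | here refl = x∈w
    ... | there v∈w = v∈w

∈words⇔ : (n k : ℕ) (w : List ℕ) → w ∈ words n k ⇔ (length w ≡ k × All (_< n) w)
∈words⇔ n k w = mk⇔ (sound k w) (λ (len , bnd) → complete k w len bnd)
  where
  extend : List ℕ → List (List ℕ)
  extend w = map (_∷ w) (upTo n)
  sound : ∀ k w → w ∈ words n k → length w ≡ k × All (_< n) w
  sound zero    w (here refl) = refl , []
  sound (suc k) w w∈ with find (∈-concatMap⁻ extend {xs = words n k} w∈)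
  ... | w′ , w′∈ , w∈ext with ∈-map⁻ (_∷ w′) w∈ext
  ... | v , v∈ , refl = let len , bnd = sound k w′ w′∈ in cong suc len , ∈-upTo⁻ v∈ ∷ bnd
  complete : ∀ k w → length w ≡ k → All (_< n) w → w ∈ words n k
  complete zero    []      refl []          = here refl
  complete (suc k) (v ∷ w) refl (v<n ∷ bnd) =
    ∈-concatMap-intro extend (complete k w refl bnd) (∈-map⁺ (_∷ w) (∈-upTo⁺ v<n))

words-unique : (n k : ℕ) → Unique (words n k)
words-unique n zero    = [] ∷ []
words-unique n (suc k) =
  unique-concatMap (λ w → map (_∷ w) (upTo n)) tail (words n k) (words-unique n k)
    (λ _ → Uniq.map⁺ (λ { refl → refl }) (Uniq.upTo⁺ n))
    (λ _ a∈ → let _ , _ , a≡ = ∈-map⁻ _ a∈ in cong tail a≡)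
  where
  tail : List ℕ → List ℕ
  tail []      = []
  tail (_ ∷ w) = w

take-length-++ : (p q : List ℕ) → take (length p) (p ++ q) ≡ p
take-length-++ []      q = refl
take-length-++ (x ∷ p) q = cong (x ∷_) (take-length-++ p q)

covering⇒permutation : ∀ n w → length w ≡ n → (∀ v → v < n → v ∈ w) → Unique w
covering⇒permutation n w len covers = covering⇒unique w (upTo n) (Uniq.upTo⁺ n) (λ v∈ → covers _ (∈-upTo⁻ v∈))
  (ℕP.≤-reflexive (trans len (sym (LP.length-upTo n))))

record IsArcPerm (n : ℕ) (w : List ℕ) : Set where
  field
    length≡   : length w ≡ n
    bounded   : ∀ {v} → v ∈ w → v < n
    covers    : ∀ v → v < n → v ∈ w
    unique    : Unique w
    intervals : ∀ p q → w ≡ p ++ q → p ≢ [] → IsInterval n p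

-- isArcᵇ tests the nonempty prefixes 'take j w', 1 ≤ j ≤ n, i.e. all nonempty prefixes of a word of length n.
isArcᵇ⇔ : (n : ℕ) (w : List ℕ) → length w ≡ n →
  T (isArcᵇ n w) ⇔ (∀ p q → w ≡ p ++ q → p ≢ [] → IsInterval n p)
isArcᵇ⇔ n w len = mk⇔ sound complete
  where
  sound : T (isArcᵇ n w) → ∀ p q → w ≡ p ++ q → p ≢ [] → IsInterval n p
  sound h []      q e       p≢[] = ⊥-elim (p≢[] refl)
  sound h (x ∷ p) q refl    _    =
    to (isIntervalᵇ⇔ n (x ∷ p)) (subst (T ∘ isIntervalᵇ n) (take-length-++ (x ∷ p) q)
      (All.lookup (to (allᵇ⇔All _ (range 1 n)) h) (∈-map⁺ (1 +_) (∈-upTo⁺ p<n))))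
    where
    p<n : length p < n
    p<n = subst (length p <_) len (s≤s (ℕP.≤-trans (ℕP.m≤m+n (length p) (length q)) (ℕP.≤-reflexive (sym (LP.length-++ p)))))
  complete : (∀ p q → w ≡ p ++ q → p ≢ [] → IsInterval n p) → T (isArcᵇ n w)
  complete h = from (allᵇ⇔All _ (range 1 n)) (All.tabulate prefix)
    where
    prefix : ∀ {j} → j ∈ range 1 n → T (isIntervalᵇ n (take j w))
    prefix j∈ with ∈-map⁻ (1 +_) j∈
    ... | i , i∈ , refl = from (isIntervalᵇ⇔ n _)
      (h (take (suc i) w) (drop (suc i) w) (sym (LP.take++drop≡id (suc i) w)) (nonempty w (subst (i <_) (sym len) (∈-upTo⁻ i∈))))
      where
      nonempty : ∀ w → i < length w → take (suc i) w ≢ []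
      nonempty (_ ∷ _) _ ()

arcPerms⇔ : (n : ℕ) (w : List ℕ) → w ∈ arcPerms n ⇔ IsArcPerm n w
arcPerms⇔ n w = mk⇔ sound complete
  where
  isArc? = λ w → T? (isPermᵇ n w ∧ isArcᵇ n w)
  covers⇔ : T (isPermᵇ n w) ⇔ (∀ v → v < n → v ∈ w)
  covers⇔ = mk⇔ (λ h v v<n → to (∈ᵇ⇔∈ v w) (to (allBelow⇔ n _) h v v<n))
                (λ h → from (allBelow⇔ n _) (λ v v<n → from (∈ᵇ⇔∈ v w) (h v v<n)))
  sound : w ∈ arcPerms n → IsArcPerm n w
  sound w∈ with ∈-filter⁻ isArc? {xs = words n n} w∈
  ... | w∈words , tests with to (∈words⇔ n n w) w∈words | to T-∧ tests
  ... | len , bnd | perm , arc = record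
    { length≡   = len
    ; bounded   = All.lookup bnd
    ; covers    = to covers⇔ perm
    ; unique    = covering⇒permutation n w len (to covers⇔ perm)
    ; intervals = to (isArcᵇ⇔ n w len) arc
    }
  complete : IsArcPerm n w → w ∈ arcPerms n
  complete A = ∈-filter⁺ isArc? (from (∈words⇔ n n w) (length≡ , All.tabulate bounded))
                 (from T-∧ (from covers⇔ covers , from (isArcᵇ⇔ n w length≡) intervals))
    where open IsArcPerm A

record Spans (s : List ℕ) (a b : ℕ) : Set where
  field
    bounds : ∀ {v} → v ∈ s → a ≤ v × v < b
    hits   : ∀ {v} → a ≤ v → v < b → v ∈ s
open Spans public

spans-single : (lo : ℕ) → Spans (lo ∷ []) lo (suc lo)
spans-single lo = record { bounds = λ { (here refl) → ℕP.≤-refl , ℕP.n<1+n lo }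
                         ; hits   = λ lo≤v v<1+lo → here (ℕP.≤-antisym (ℕP.≤-pred v<1+lo) lo≤v) }

spans-top : ∀ {s s′ a t} → a ≤ t → Spans s′ a t → (∀ {x} → x ∈ s → x ≡ t ⊎ x ∈ s′) → t ∈ s →
  (∀ {x} → x ∈ s′ → x ∈ s) → Spans s a (suc t)
spans-top {s} {a = a} {t} a≤t sp split t∈s s′⊆s = record { bounds = bounds′ ; hits = hits′ }
  where
  bounds′ : ∀ {v} → v ∈ s → a ≤ v × v < suc t
  bounds′ v∈s with split v∈s
  ... | inj₁ refl = a≤t , ℕP.n<1+n t
  ... | inj₂ v∈s′ = let a≤v , v<t = bounds sp v∈s′ in a≤v , ℕP.m<n⇒m<1+n v<t
  hits′ : ∀ {v} → a ≤ v → v < suc t → v ∈ s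
  hits′ a≤v v<1+t with ℕP.m≤n⇒m<n∨m≡n (ℕP.≤-pred v<1+t)
  ... | inj₁ v<t  = s′⊆s (hits sp a≤v v<t)
  ... | inj₂ refl = t∈s

spans-bottom : ∀ {s s′ a b} → a < b → Spans s′ (suc a) b → (∀ {x} → x ∈ s → x ≡ a ⊎ x ∈ s′) → a ∈ s →
  (∀ {x} → x ∈ s′ → x ∈ s) → Spans s a b
spans-bottom {s} {a = a} {b} a<b sp split a∈s s′⊆s = record { bounds = bounds′ ; hits = hits′ }
  where
  bounds′ : ∀ {v} → v ∈ s → a ≤ v × v < b
  bounds′ v∈s with split v∈s
  ... | inj₁ refl = ℕP.≤-refl , a<b
  ... | inj₂ v∈s′ = let a<v , v<b = bounds sp v∈s′ in ℕP.<⇒≤ a<v , v<b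
  hits′ : ∀ {v} → a ≤ v → v < b → v ∈ s
  hits′ a≤v v<b with ℕP.m≤n⇒m<n∨m≡n a≤v
  ... | inj₁ a<v  = s′⊆s (hits sp a<v v<b)
  ... | inj₂ refl = a∈s

spans-min : ∀ {s lo k} → Spans s lo (lo + suc k) → lo ∈ s
spans-min sp = hits sp ℕP.≤-refl (ℕP.m<m+n _ (s≤s z≤n))

spans-max : ∀ {s lo k} → Spans s lo (lo + suc k) → lo + k ∈ s
spans-max {lo = lo} {k} sp = hits sp (ℕP.m≤m+n lo k) (subst (lo + k <_) (sym (ℕP.+-suc lo k)) (ℕP.n<1+n _))

top∉ : ∀ {s a t} → Spans s a t → t ∉ s
top∉ sp t∈s = ℕP.<-irrefl refl (proj₂ (bounds sp t∈s))

bottom∉ : ∀ {s a b} → Spans s (suc a) b → a ∉ s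
bottom∉ sp a∈s = ℕP.<-irrefl refl (proj₁ (bounds sp a∈s))

range-extension : ∀ {s s′ lo m v a b} → Spans s lo (lo + suc m) → v ∉ s → Spans s′ a b →
  (∀ {x} → x ∈ s′ → x ≡ v ⊎ x ∈ s) → v ∈ s′ → (∀ {x} → x ∈ s → x ∈ s′) →
  suc v ≡ lo ⊎ v ≡ lo + suc m
range-extension {s} {s′} {lo} {m} {v} sp v∉s sp′ split v∈s′ s⊆s′ with ℕP.<-cmp v lo
... | tri< v<lo _ _ with ℕP.m≤n⇒m<n∨m≡n v<lo
...   | inj₂ 1+v≡lo = inj₁ 1+v≡lo
...   | inj₁ 1+v<lo = ⊥-elim (gap (hits sp′ (ℕP.≤-trans (proj₁ (bounds sp′ v∈s′)) (ℕP.n≤1+n v))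
                                            (ℕP.<-trans 1+v<lo (proj₂ (bounds sp′ lo∈s′)))))
  where
  -- v+1 lies strictly between v and lo, so it belongs to neither v nor s
  gap : suc v ∉ s′
  gap 1+v∈ with split 1+v∈
  ... | inj₁ 1+v≡v = ℕP.<-irrefl (sym 1+v≡v) (ℕP.n<1+n v)
  ... | inj₂ 1+v∈s = ℕP.<-irrefl refl (ℕP.<-≤-trans 1+v<lo (proj₁ (bounds sp 1+v∈s)))
  lo∈s′ : lo ∈ s′
  lo∈s′ = s⊆s′ (hits sp ℕP.≤-refl (ℕP.m<m+n lo (s≤s z≤n)))
range-extension sp v∉s _ _ _ _ | tri≈ _ refl _ = ⊥-elim (v∉s (hits sp ℕP.≤-refl (ℕP.m<m+n _ (s≤s z≤n))))
range-extension {s} {s′} {lo} {m} {v} sp v∉s sp′ split v∈s′ s⊆s′ | tri> _ _ lo<v with ℕP.<-cmp v (lo + suc m)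
... | tri< v<top _ _ = ⊥-elim (v∉s (hits sp (ℕP.<⇒≤ lo<v) v<top))
... | tri≈ _ v≡top _ = inj₂ v≡top
... | tri> _ _ top<v = ⊥-elim (gap (hits sp′ (ℕP.≤-trans (proj₁ (bounds sp′ lo∈s′)) (ℕP.m≤m+n lo (suc m)))
                                           (ℕP.<-trans top<v (proj₂ (bounds sp′ v∈s′)))))
  where
  -- the old maximum plus one lies strictly between s and v
  gap : lo + suc m ∉ s′
  gap top∈ with split top∈
  ... | inj₁ top≡v = ℕP.<-irrefl top≡v top<v
  ... | inj₂ top∈s = top∉ sp top∈s
  lo∈s′ : lo ∈ s′
  lo∈s′ = s⊆s′ (hits sp ℕP.≤-refl (ℕP.m<m+n lo (s≤s z≤n)))

-- prefixRanged lo k: arrangements of lo, …, lo+k-1 all of whose prefixes are ranges of consecutive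
-- integers; each arises from a shorter one by appending its new maximum or its new minimum.
prefixRanged : ℕ → ℕ → List (List ℕ)
prefixRanged lo zero          = [] ∷ []
prefixRanged lo (suc zero)    = (lo ∷ []) ∷ []
prefixRanged lo (suc (suc m)) =
  map (_∷ʳ (lo + suc m)) (prefixRanged lo (suc m)) ++ map (_∷ʳ lo) (prefixRanged (suc lo) (suc m))

-- suffixRanged lo k: the mirror image, every suffix is a range; grown by prepending a new minimum or maximum.
suffixRanged : ℕ → ℕ → List (List ℕ)
suffixRanged lo zero          = [] ∷ []
suffixRanged lo (suc zero)    = (lo ∷ []) ∷ []
suffixRanged lo (suc (suc m)) =
  map (lo ∷_) (suffixRanged (suc lo) (suc m)) ++ map ((lo + suc m) ∷_) (suffixRanged lo (suc m))

record Arrangement (u : List ℕ) (lo k : ℕ) : Set where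
  field
    len   : length u ≡ k
    span  : Spans u lo (lo + k)
    nodup : Unique u
open Arrangement public

∈-∷ʳ⁻ : ∀ {x t} (u : List ℕ) → x ∈ u ∷ʳ t → x ≡ t ⊎ x ∈ u
∈-∷ʳ⁻ u x∈ with ∈-++⁻ u x∈
... | inj₁ x∈u        = inj₂ x∈u
... | inj₂ (here x≡t) = inj₁ x≡t

∈-∷⁻ : ∀ {x t} {u : List ℕ} → x ∈ t ∷ u → x ≡ t ⊎ x ∈ u
∈-∷⁻ (here x≡t) = inj₁ x≡t
∈-∷⁻ (there x∈u) = inj₂ x∈u

length-∷ʳ : (u : List ℕ) (t : ℕ) → length (u ∷ʳ t) ≡ suc (length u)
length-∷ʳ u t = trans (LP.length-++ u) (ℕP.+-comm (length u) 1)

arrangement-∷ʳtop : ∀ {u lo m} → Arrangement u lo (suc m) → Arrangement (u ∷ʳ (lo + suc m)) lo (suc (suc m))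
arrangement-∷ʳtop {u} {lo} {m} A = record
  { len   = trans (length-∷ʳ u _) (cong suc (len A))
  ; span  = subst (Spans (u ∷ʳ (lo + suc m)) lo) (sym (ℕP.+-suc lo (suc m)))
              (spans-top (ℕP.m≤m+n lo (suc m)) (span A) (∈-∷ʳ⁻ u) (∈-++⁺ʳ u (here refl)) ∈-++⁺ˡ)
  ; nodup = unique-++⁺ (nodup A) ([] ∷ []) (λ { t∈u (here refl) → top∉ (span A) t∈u }) }

arrangement-∷ʳbottom : ∀ {u lo m} → Arrangement u (suc lo) (suc m) → Arrangement (u ∷ʳ lo) lo (suc (suc m))
arrangement-∷ʳbottom {u} {lo} {m} A = record
  { len   = trans (length-∷ʳ u _) (cong suc (len A))
  ; span  = spans-bottom (ℕP.m<m+n lo (s≤s z≤n)) (subst (Spans u (suc lo)) (sym (ℕP.+-suc lo (suc m))) (span A))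
              (∈-∷ʳ⁻ u) (∈-++⁺ʳ u (here refl)) ∈-++⁺ˡ
  ; nodup = unique-++⁺ (nodup A) ([] ∷ []) (λ { b∈u (here refl) → bottom∉ (span A) b∈u }) }

arrangement-∷top : ∀ {d lo m} → Arrangement d lo (suc m) → Arrangement ((lo + suc m) ∷ d) lo (suc (suc m))
arrangement-∷top {d} {lo} {m} A = record
  { len   = cong suc (len A)
  ; span  = subst (Spans ((lo + suc m) ∷ d) lo) (sym (ℕP.+-suc lo (suc m)))
              (spans-top (ℕP.m≤m+n lo (suc m)) (span A) ∈-∷⁻ (here refl) there)
  ; nodup = unique-∷ (top∉ (span A)) (nodup A) }

arrangement-∷bottom : ∀ {d lo m} → Arrangement d (suc lo) (suc m) → Arrangement (lo ∷ d) lo (suc (suc m))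
arrangement-∷bottom {d} {lo} {m} A = record
  { len   = cong suc (len A)
  ; span  = spans-bottom (ℕP.m<m+n lo (s≤s z≤n)) (subst (Spans d (suc lo)) (sym (ℕP.+-suc lo (suc m))) (span A))
              ∈-∷⁻ (here refl) there
  ; nodup = unique-∷ (bottom∉ (span A)) (nodup A) }

arrangement-single : (lo : ℕ) → Arrangement (lo ∷ []) lo 1
arrangement-single lo = record
  { len = refl ; span = subst (Spans (lo ∷ []) lo) (ℕP.+-comm 1 lo) (spans-single lo) ; nodup = [] ∷ [] }

prefixRanged-arrangement : ∀ lo m u → u ∈ prefixRanged lo (suc m) → Arrangement u lo (suc m)
prefixRanged-arrangement lo zero    u (here refl) = arrangement-single lo
prefixRanged-arrangement lo (suc m) u u∈ with ∈-++⁻ (map (_∷ʳ (lo + suc m)) (prefixRanged lo (suc m))) u∈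
... | inj₁ u∈top with ∈-map⁻ (_∷ʳ (lo + suc m)) u∈top
...   | u′ , u′∈ , refl = arrangement-∷ʳtop (prefixRanged-arrangement lo m u′ u′∈)
prefixRanged-arrangement lo (suc m) u u∈ | inj₂ u∈bot with ∈-map⁻ (_∷ʳ lo) u∈bot
...   | u′ , u′∈ , refl = arrangement-∷ʳbottom (prefixRanged-arrangement (suc lo) m u′ u′∈)

suffixRanged-arrangement : ∀ lo m d → d ∈ suffixRanged lo (suc m) → Arrangement d lo (suc m)
suffixRanged-arrangement lo zero    d (here refl) = arrangement-single lo
suffixRanged-arrangement lo (suc m) d d∈ with ∈-++⁻ (map (lo ∷_) (suffixRanged (suc lo) (suc m))) d∈
... | inj₁ d∈bot with ∈-map⁻ (lo ∷_) d∈bot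
...   | d′ , d′∈ , refl = arrangement-∷bottom (suffixRanged-arrangement (suc lo) m d′ d′∈)
suffixRanged-arrangement lo (suc m) d d∈ | inj₂ d∈top with ∈-map⁻ ((lo + suc m) ∷_) d∈top
...   | d′ , d′∈ , refl = arrangement-∷top (suffixRanged-arrangement lo m d′ d′∈)

∷ʳ-split : ∀ (p q u : List ℕ) t → p ++ q ≡ u ∷ʳ t →
  (q ≡ [] × p ≡ u ∷ʳ t) ⊎ ∃[ q′ ] (q ≡ q′ ∷ʳ t × p ++ q′ ≡ u)
∷ʳ-split []      q u       t e = inj₂ (u , e , refl)
∷ʳ-split (a ∷ p) q []      t e with LP.∷-injective e
... | refl , e′ with LP.++-conicalˡ p q e′ | LP.++-conicalʳ p q e′
... | refl | refl = inj₁ (refl , refl)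
∷ʳ-split (a ∷ p) q (b ∷ u) t e with LP.∷-injective e
... | refl , e′ with ∷ʳ-split p q u t e′
... | inj₁ (q≡[] , p≡) = inj₁ (q≡[] , cong (a ∷_) p≡)
... | inj₂ (q′ , q≡ , p≡) = inj₂ (q′ , q≡ , cong (a ∷_) p≡)

∷ʳ≢[] : (u : List ℕ) (t : ℕ) → u ∷ʳ t ≢ []
∷ʳ≢[] []      t ()
∷ʳ≢[] (_ ∷ _) t ()

prefixRanged-prefix : ∀ lo m u → u ∈ prefixRanged lo (suc m) → ∀ p q → u ≡ p ++ q → p ≢ [] →
  ∃[ a ] p ∈ prefixRanged a (length p)
prefixRanged-prefix lo zero u (here refl) []            q       e    p≢[] = ⊥-elim (p≢[] refl)
prefixRanged-prefix lo zero u (here refl) (x ∷ [])      []      refl _    = lo , here refl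
prefixRanged-prefix lo zero u (here refl) (x ∷ [])      (_ ∷ _) ()   _
prefixRanged-prefix lo zero u (here refl) (x ∷ _ ∷ _)   q       ()   _
prefixRanged-prefix lo (suc m) u u∈ p q e p≢[] with ∈-++⁻ (map (_∷ʳ (lo + suc m)) (prefixRanged lo (suc m))) u∈
... | inj₁ u∈top with ∈-map⁻ (_∷ʳ (lo + suc m)) u∈top
...   | u′ , u′∈ , refl with ∷ʳ-split p q u′ _ (sym e)
...     | inj₁ (refl , refl) = lo , subst (λ k → u′ ∷ʳ (lo + suc m) ∈ prefixRanged lo k) (sym (len (arrangement-∷ʳtop (prefixRanged-arrangement lo m u′ u′∈)))) u∈
...     | inj₂ (q′ , _ , e′) = prefixRanged-prefix lo m u′ u′∈ p q′ (sym e′) p≢[]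
prefixRanged-prefix lo (suc m) u u∈ p q e p≢[] | inj₂ u∈bot with ∈-map⁻ (_∷ʳ lo) u∈bot
...   | u′ , u′∈ , refl with ∷ʳ-split p q u′ _ (sym e)
...     | inj₁ (refl , refl) = lo , subst (λ k → u′ ∷ʳ lo ∈ prefixRanged lo k) (sym (len (arrangement-∷ʳbottom (prefixRanged-arrangement (suc lo) m u′ u′∈)))) u∈
...     | inj₂ (q′ , _ , e′) = prefixRanged-prefix (suc lo) m u′ u′∈ p q′ (sym e′) p≢[]

suffixRanged-suffix : ∀ lo m d → d ∈ suffixRanged lo (suc m) → ∀ p q → d ≡ p ++ q → q ≢ [] →
  ∃[ c ] q ∈ suffixRanged c (length q)
suffixRanged-suffix lo zero d (here refl) []          q  refl _    = lo , here refl
suffixRanged-suffix lo zero d (here refl) (x ∷ [])    [] refl q≢[] = ⊥-elim (q≢[] refl)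
suffixRanged-suffix lo zero d (here refl) (x ∷ _ ∷ _) q  ()   _
suffixRanged-suffix lo (suc m) d d∈ [] q refl _ = lo , subst (λ k → d ∈ suffixRanged lo k) (sym (len (suffixRanged-arrangement lo (suc m) d d∈))) d∈
suffixRanged-suffix lo (suc m) d d∈ (x ∷ p) q e q≢[] with ∈-++⁻ (map (lo ∷_) (suffixRanged (suc lo) (suc m))) d∈
... | inj₁ d∈bot with ∈-map⁻ (lo ∷_) d∈bot
...   | d′ , d′∈ , refl = suffixRanged-suffix (suc lo) m d′ d′∈ p q (proj₂ (LP.∷-injective e)) q≢[]
suffixRanged-suffix lo (suc m) d d∈ (x ∷ p) q e q≢[] | inj₂ d∈top with ∈-map⁻ ((lo + suc m) ∷_) d∈top
...   | d′ , d′∈ , refl = suffixRanged-suffix lo m d′ d′∈ p q (proj₂ (LP.∷-injective e)) q≢[]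

prefixRanged-complete : ∀ m u → length u ≡ suc m → Unique u →
  (∀ p q → u ≡ p ++ q → p ≢ [] → ∃₂ λ a b → Spans p a b) → ∃[ lo ] u ∈ prefixRanged lo (suc m)
prefixRanged-complete m u len≡ uu prefixes with initLast u
prefixRanged-complete m       .[]              ()   uu prefixes | []
prefixRanged-complete zero    .([] ∷ʳ t)       len≡ uu prefixes | [] ∷ʳ′ t = t , here refl
prefixRanged-complete zero    .((x ∷ u′) ∷ʳ t) len≡ uu prefixes | (x ∷ u′) ∷ʳ′ t
  with trans (sym (length-∷ʳ (x ∷ u′) t)) len≡
... | ()
prefixRanged-complete (suc m) .(u′ ∷ʳ t) len≡ uu prefixes | u′ ∷ʳ′ t =
  grow lo u′∈ (range-extension (span (prefixRanged-arrangement lo m u′ u′∈)) t∉u′ (proj₂ (proj₂ whole))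
                               (∈-∷ʳ⁻ u′) (∈-++⁺ʳ u′ (here refl)) ∈-++⁺ˡ)
  where
  t∉u′ : t ∉ u′
  t∉u′ t∈ = proj₂ (proj₂ (unique-++⁻ u′ uu)) t∈ (here refl)
  ih : ∃[ lo ] u′ ∈ prefixRanged lo (suc m)
  ih = prefixRanged-complete m u′ (ℕP.suc-injective (trans (sym (length-∷ʳ u′ t)) len≡)) (proj₁ (unique-++⁻ u′ uu))
         (λ p q e p≢[] → prefixes p (q ∷ʳ t) (trans (cong (_∷ʳ t) e) (LP.++-assoc p q (t ∷ []))) p≢[])
  lo = proj₁ ih
  u′∈ = proj₂ ih
  whole = prefixes (u′ ∷ʳ t) [] (sym (LP.++-identityʳ _)) (∷ʳ≢[] u′ t)
  grow : ∀ lo → u′ ∈ prefixRanged lo (suc m) → suc t ≡ lo ⊎ t ≡ lo + suc m → ∃[ lo′ ] u′ ∷ʳ t ∈ prefixRanged lo′ (suc (suc m))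
  grow .(suc t) u′∈ (inj₁ refl) = t , ∈-++⁺ʳ (map (_∷ʳ (t + suc m)) (prefixRanged t (suc m))) (∈-map⁺ (_∷ʳ t) u′∈)
  grow lo       u′∈ (inj₂ refl) = lo , ∈-++⁺ˡ (∈-map⁺ (_∷ʳ (lo + suc m)) u′∈)

suffixRanged-complete : ∀ m d → length d ≡ suc m → Unique d →
  (∀ p q → d ≡ p ++ q → q ≢ [] → ∃₂ λ a b → Spans q a b) → ∃[ lo ] d ∈ suffixRanged lo (suc m)
suffixRanged-complete zero    (t ∷ [])          len≡ ud         suffixes = t , here refl
suffixRanged-complete (suc m) (t ∷ d′)          len≡ (t∉ ∷ ud′) suffixes =
  grow lo d′∈ (range-extension (span (suffixRanged-arrangement lo m d′ d′∈)) (λ t∈ → All.lookup t∉ t∈ refl)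
                               (proj₂ (proj₂ whole)) ∈-∷⁻ (here refl) there)
  where
  ih : ∃[ lo ] d′ ∈ suffixRanged lo (suc m)
  ih = suffixRanged-complete m d′ (ℕP.suc-injective len≡) ud′ (λ p q e q≢[] → suffixes (t ∷ p) q (cong (t ∷_) e) q≢[])
  lo = proj₁ ih
  d′∈ = proj₂ ih
  whole = suffixes [] (t ∷ d′) refl (λ ())
  grow : ∀ lo → d′ ∈ suffixRanged lo (suc m) → suc t ≡ lo ⊎ t ≡ lo + suc m → ∃[ lo′ ] t ∷ d′ ∈ suffixRanged lo′ (suc (suc m))
  grow .(suc t) d′∈ (inj₁ refl) = t , ∈-++⁺ˡ (∈-map⁺ (t ∷_) d′∈)
  grow lo       d′∈ (inj₂ refl) = lo , ∈-++⁺ʳ (map (lo ∷_) (suffixRanged (suc lo) (suc m))) (∈-map⁺ ((lo + suc m) ∷_) d′∈)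

++-split : ∀ (p q u r : List ℕ) → p ++ q ≡ u ++ r →
  ∃[ q′ ] (u ≡ p ++ q′ × q ≡ q′ ++ r) ⊎ ∃[ p′ ] (p ≡ u ++ p′ × r ≡ p′ ++ q)
++-split []      q u       r e = inj₁ (u , refl , e)
++-split (x ∷ p) q []      r e = inj₂ (x ∷ p , refl , sym e)
++-split (x ∷ p) q (y ∷ u) r e with LP.∷-injective e
... | refl , e′ with ++-split p q u r e′
... | inj₁ (q′ , u≡ , q≡) = inj₁ (q′ , cong (x ∷_) u≡ , q≡)
... | inj₂ (p′ , p≡ , r≡) = inj₂ (p′ , cong (x ∷_) p≡ , r≡)

spans⇒interval : ∀ n p a k → Spans p a (a + suc k) → a + k < n → IsInterval n p
spans⇒interval n p a k sp top<n =
  a , a + k , ℕP.≤-<-trans (ℕP.m≤m+n a k) top<n , top<n , ℕP.m≤m+n a k , inj₁ segment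
  where
  segment : SameBelow n p (Segment a (a + k))
  segment v _ = (λ v∈ → let a≤v , v<top = bounds sp v∈ in a≤v , ℕP.≤-pred (subst (v <_) (ℕP.+-suc a k) v<top))
              , (λ (a≤v , v≤top) → hits sp a≤v (subst (v <_) (sym (ℕP.+-suc a k)) (s≤s v≤top)))

prefixRanged-intervals : ∀ n lo k u → u ∈ prefixRanged lo (suc k) → (∀ {v} → v ∈ u → v < n) →
  ∀ p q → u ≡ p ++ q → p ≢ [] → IsInterval n p
prefixRanged-intervals n lo k u u∈ bounded p q e p≢[] with prefixRanged-prefix lo k u u∈ p q e p≢[]
... | a , p∈ with p
...   | []     = ⊥-elim (p≢[] refl)
...   | x ∷ p′ = spans⇒interval n (x ∷ p′) a (length p′) (span (prefixRanged-arrangement a (length p′) (x ∷ p′) p∈))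
                   (bounded (subst (_ ∈_) (sym e) (∈-++⁺ˡ top∈p)))
  where
  top∈p : a + length p′ ∈ x ∷ p′
  top∈p = hits (span (prefixRanged-arrangement a (length p′) (x ∷ p′) p∈)) (ℕP.m≤m+n a _)
            (subst (a + length p′ <_) (sym (ℕP.+-suc a (length p′))) (ℕP.n<1+n _))

covering⇒interval : ∀ n p → 0 < n → (∀ v → v < n → v ∈ p) → IsInterval n p
covering⇒interval (suc n′) p _ covers =
  0 , n′ , s≤s z≤n , ℕP.n<1+n n′ , z≤n , inj₁ (λ v v<n → (λ _ → z≤n , ℕP.≤-pred v<n) , (λ _ → covers v v<n))

complement⇒interval : ∀ n p q c → Unique (p ++ q) → (∀ v → v < n → v ∈ p ++ q) → q ≢ [] →
  Spans q (suc c) (suc c + length q) → suc c + length q < n → IsInterval n p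
complement⇒interval n p q c uniq covers q≢[] sp top<n =
  c , top , ℕP.<-trans (ℕP.n<1+n c) (ℕP.≤-<-trans (ℕP.m≤m+n (suc c) _) top<n) , top<n ,
  ℕP.≤-trans (ℕP.n≤1+n c) (ℕP.m≤m+n (suc c) _) , inj₂ (λ v v<n → outside v , inside v v<n)
  where
  top = suc c + length q
  disjoint = proj₂ (proj₂ (unique-++⁻ p uniq))
  0<|q| : 0 < length q
  0<|q| = nonempty q q≢[]
    where
    nonempty : ∀ q → q ≢ [] → 0 < length q
    nonempty []      q≢[] = ⊥-elim (q≢[] refl)
    nonempty (_ ∷ _) _    = s≤s z≤n
  outside : ∀ v → v ∈ p → top ≤ v ⊎ v ≤ c
  outside v v∈p with ℕP.<-cmp v (suc c)
  ... | tri< v<1+c _ _ = inj₂ (ℕP.≤-pred v<1+c)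
  ... | tri≈ _ refl _ = ⊥-elim (disjoint v∈p (hits sp ℕP.≤-refl (ℕP.m<m+n _ 0<|q|)))
  ... | tri> _ _ c<v with ℕP.<-cmp v top
  ...   | tri< v<top _ _ = ⊥-elim (disjoint v∈p (hits sp (ℕP.<⇒≤ c<v) v<top))
  ...   | tri≈ _ v≡top _ = inj₁ (ℕP.≤-reflexive (sym v≡top))
  ...   | tri> _ _ top<v = inj₁ (ℕP.<⇒≤ top<v)
  inside : ∀ v → v < n → top ≤ v ⊎ v ≤ c → v ∈ p
  inside v v<n v-out with ∈-++⁻ p (covers v v<n)
  ... | inj₁ v∈p = v∈p
  ... | inj₂ v∈q with bounds sp v∈q | v-out
  ...   | _ , v<top | inj₁ top≤v = ⊥-elim (ℕP.<-irrefl refl (ℕP.<-≤-trans v<top top≤v))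
  ...   | c<v , _   | inj₂ v≤c   = ⊥-elim (ℕP.<-irrefl refl (ℕP.≤-<-trans c<v (s≤s v≤c)))

∈-splice⁻ : ∀ {v z} (u d : List ℕ) → v ∈ u ++ z ∷ d → v ∈ u ⊎ v ≡ z ⊎ v ∈ d
∈-splice⁻ u d v∈ with ∈-++⁻ u v∈
... | inj₁ v∈u         = inj₁ v∈u
... | inj₂ (here v≡z)  = inj₂ (inj₁ v≡z)
... | inj₂ (there v∈d) = inj₂ (inj₂ v∈d)

∈-splice⁺ : ∀ {v z} (u d : List ℕ) → v ∈ u ⊎ v ≡ z ⊎ v ∈ d → v ∈ u ++ z ∷ d
∈-splice⁺ u d (inj₁ v∈u)        = ∈-++⁺ˡ v∈u
∈-splice⁺ u d (inj₂ (inj₁ refl)) = ∈-++⁺ʳ u (here refl)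
∈-splice⁺ u d (inj₂ (inj₂ v∈d))  = ∈-++⁺ʳ u (there v∈d)

-- The nonempty suffixes of d lie strictly inside (0, n-1): such a d contributes no interval condition
-- beyond the one checked in 'complement⇒interval'.
InnerSuffixes : ℕ → List ℕ → Set
InnerSuffixes n d = ∀ p q → d ≡ p ++ q → q ≢ [] → ∃[ c ] (Spans q (suc c) (suc c + length q) × suc c + length q < n)

splice-isArcPerm : ∀ n u z d → length (u ++ z ∷ d) ≡ n → (∀ {v} → v ∈ u ++ z ∷ d → v < n) →
  (∀ v → v < n → v ∈ u ++ z ∷ d) → (∀ p q → u ≡ p ++ q → p ≢ [] → IsInterval n p) → InnerSuffixes n d →
  IsArcPerm n (u ++ z ∷ d)
splice-isArcPerm n u z d len bounded covers u-intervals d-inner = record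
  { length≡ = len ; bounded = bounded ; covers = covers ; unique = uniq ; intervals = intervals }
  where
  uniq = covering⇒permutation n _ len covers
  intervals : ∀ p q → u ++ z ∷ d ≡ p ++ q → p ≢ [] → IsInterval n p
  intervals p q e p≢[] with ++-split p q u (z ∷ d) (sym e)
  ... | inj₁ (q′ , u≡ , _)      = u-intervals p q′ u≡ p≢[]
  ... | inj₂ ([] , refl , _)    = u-intervals (u ++ []) [] (sym (trans (LP.++-identityʳ _) (LP.++-identityʳ _))) p≢[]
  ... | inj₂ (x ∷ p″ , refl , r≡) with LP.∷-injective r≡
  ...   | refl , d≡ with q
  ...     | [] = covering⇒interval n p (ℕP.≤-<-trans z≤n (bounded (∈-++⁺ʳ u (here refl))))
                   (λ v v<n → subst (v ∈_) (LP.++-identityʳ _) (subst (v ∈_) e (covers v v<n)))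
  ...     | y ∷ q″ with d-inner p″ (y ∷ q″) d≡ (λ ())
  ...       | c , sp , top<n = complement⇒interval n p (y ∷ q″) c (subst Unique e uniq)
                                 (λ v v<n → subst (v ∈_) e (covers v v<n)) (λ ()) sp top<n

suffixRanged-inner : ∀ n lo L d → d ∈ suffixRanged (suc lo) (suc L) → suc lo + suc L < n → InnerSuffixes n d
suffixRanged-inner n lo L d d∈ top<n p []      e q≢[] = ⊥-elim (q≢[] refl)
suffixRanged-inner n lo L d d∈ top<n p (y ∷ q) e _ with suffixRanged-suffix (suc lo) L d d∈ p (y ∷ q) e (λ ())
... | c₀ , q∈ = shift c₀ (span (suffixRanged-arrangement c₀ (length q) (y ∷ q) q∈))
                  (proj₁ (bounds (span A) (q⊆d (hits (span (suffixRanged-arrangement c₀ (length q) (y ∷ q) q∈))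
                     ℕP.≤-refl (ℕP.m<m+n c₀ (s≤s z≤n))))))
  where
  A = suffixRanged-arrangement (suc lo) L d d∈
  q⊆d : ∀ {v} → v ∈ y ∷ q → v ∈ d
  q⊆d v∈ = subst (_ ∈_) (sym e) (∈-++⁺ʳ p v∈)
  -- the range of the suffix starts above lo, hence at c+1 for some c
  shift : ∀ c₀ → Spans (y ∷ q) c₀ (c₀ + suc (length q)) → suc lo ≤ c₀ →
    ∃[ c ] (Spans (y ∷ q) (suc c) (suc c + length (y ∷ q)) × suc c + length (y ∷ q) < n)
  shift (suc c) sp _ = c , sp , ℕP.≤-<-trans (proj₂ (bounds (span A) (q⊆d top∈))) top<n
    where
    top∈ : c + suc (length q) ∈ y ∷ q
    top∈ = hits sp (subst (suc c ≤_) (sym (ℕP.+-suc c (length q))) (s≤s (ℕP.m≤m+n c (length q)))) ℕP.≤-refl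

splices : ℕ → List (List ℕ) → List (List ℕ) → List (List ℕ)
splices z Us Ds = concatMap (λ u → map (λ d → u ++ z ∷ d) Ds) Us

∈-splices⁻ : ∀ {w} z Us Ds → w ∈ splices z Us Ds → ∃₂ λ u d → u ∈ Us × d ∈ Ds × w ≡ u ++ z ∷ d
∈-splices⁻ z Us Ds w∈ with find (∈-concatMap⁻ (λ u → map (λ d → u ++ z ∷ d) Ds) {xs = Us} w∈)
... | u , u∈ , w∈u with ∈-map⁻ (λ d → u ++ z ∷ d) w∈u
...   | d , d∈ , w≡ = u , d , u∈ , d∈ , w≡

∈-splices⁺ : ∀ {u d} z Us Ds → u ∈ Us → d ∈ Ds → u ++ z ∷ d ∈ splices z Us Ds
∈-splices⁺ {u} z Us Ds u∈ d∈ = ∈-concatMap-intro (λ u → map (λ d → u ++ z ∷ d) Ds) u∈ (∈-map⁺ (λ d → u ++ z ∷ d) d∈)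

zeroBlock : ℕ → ℕ → List (List ℕ)
zeroBlock n j = splices 0 (prefixRanged (n ∸ j) j) (suffixRanged 1 (n ∸ j ∸ 1))

topBlock : ℕ → ℕ → List (List ℕ)
topBlock n j = splices (n ∸ 1) (prefixRanged 0 j) (suffixRanged j (n ∸ j ∸ 1))

arcList : ℕ → List (List ℕ)
arcList n = prefixRanged 0 n ++ concatMap (λ j → zeroBlock n j ++ topBlock n j) (range 1 (n ∸ 2))

prefixRanged-isArcPerm : ∀ k u → u ∈ prefixRanged 0 (suc k) → IsArcPerm (suc k) u
prefixRanged-isArcPerm k u u∈ = record
  { length≡ = len A ; bounded = bounded′ ; covers = λ v v<n → hits (span A) z≤n v<n
  ; unique = nodup A ; intervals = prefixRanged-intervals (suc k) 0 k u u∈ bounded′ }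
  where
  A = prefixRanged-arrangement 0 k u u∈
  bounded′ : ∀ {v} → v ∈ u → v < suc k
  bounded′ v∈ = proj₂ (bounds (span A) v∈)

zeroBlock-isArcPerm : ∀ k r u d → u ∈ prefixRanged (suc (suc r)) (suc k) → d ∈ suffixRanged 1 (suc r) →
  IsArcPerm (suc k + suc (suc r)) (u ++ 0 ∷ d)
zeroBlock-isArcPerm k r u d u∈ d∈ =
  splice-isArcPerm n u 0 d (trans (LP.length-++ u) (cong₂ _+_ (len U) (cong suc (len D)))) bounded′ covers′
    (prefixRanged-intervals n (suc (suc r)) k u u∈ (λ v∈ → bounded′ (∈-++⁺ˡ v∈)))
    (suffixRanged-inner n 0 r d d∈ (subst (suc (suc r) <_) n≡ (ℕP.m<m+n _ (s≤s z≤n))))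
  where
  n = suc k + suc (suc r)
  U = prefixRanged-arrangement (suc (suc r)) k u u∈
  D = suffixRanged-arrangement 1 r d d∈
  n≡ : suc (suc r) + suc k ≡ n
  n≡ = ℕP.+-comm (suc (suc r)) (suc k)
  bounded′ : ∀ {v} → v ∈ u ++ 0 ∷ d → v < n
  bounded′ {v} v∈ with ∈-splice⁻ u d v∈
  ... | inj₁ v∈u         = subst (v <_) n≡ (proj₂ (bounds (span U) v∈u))
  ... | inj₂ (inj₁ refl) = s≤s z≤n
  ... | inj₂ (inj₂ v∈d)  = ℕP.<-≤-trans (proj₂ (bounds (span D) v∈d)) (subst (suc (suc r) ≤_) n≡ (ℕP.m≤m+n _ _))
  -- 0 is z, 1, …, r+1 lie in d and r+2, …, n-1 in u
  covers′ : ∀ v → v < n → v ∈ u ++ 0 ∷ d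
  covers′ zero    _   = ∈-splice⁺ u d (inj₂ (inj₁ refl))
  covers′ (suc v) v<n with ℕP.<-cmp (suc v) (suc (suc r))
  ... | tri< v<lo _ _ = ∈-splice⁺ u d (inj₂ (inj₂ (hits (span D) (s≤s z≤n) v<lo)))
  ... | tri≈ _ refl _ = ∈-splice⁺ u d (inj₁ (hits (span U) ℕP.≤-refl (subst (suc v <_) (sym n≡) v<n)))
  ... | tri> _ _ lo<v = ∈-splice⁺ u d (inj₁ (hits (span U) (ℕP.<⇒≤ lo<v) (subst (suc v <_) (sym n≡) v<n)))

topBlock-isArcPerm : ∀ k r u d → u ∈ prefixRanged 0 (suc k) → d ∈ suffixRanged (suc k) (suc r) →
  IsArcPerm (suc k + suc (suc r)) (u ++ (suc k + suc r) ∷ d)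
topBlock-isArcPerm k r u d u∈ d∈ =
  splice-isArcPerm n u z d (trans (LP.length-++ u) (cong₂ _+_ (len U) (cong suc (len D)))) bounded′ covers′
    (prefixRanged-intervals n 0 k u u∈ (λ v∈ → bounded′ (∈-++⁺ˡ v∈)))
    (suffixRanged-inner n k r d d∈ top<n)
  where
  n = suc k + suc (suc r)
  z = suc k + suc r
  U = prefixRanged-arrangement 0 k u u∈
  D = suffixRanged-arrangement (suc k) r d d∈
  top<n : z < n
  top<n = subst (z <_) (sym (ℕP.+-suc (suc k) (suc r))) (ℕP.n<1+n z)
  bounded′ : ∀ {v} → v ∈ u ++ z ∷ d → v < n
  bounded′ v∈ with ∈-splice⁻ u d v∈
  ... | inj₁ v∈u         = ℕP.<-≤-trans (proj₂ (bounds (span U) v∈u)) (ℕP.m≤m+n (suc k) _)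
  ... | inj₂ (inj₁ refl) = top<n
  ... | inj₂ (inj₂ v∈d)  = ℕP.<-trans (proj₂ (bounds (span D) v∈d)) top<n
  -- 0, …, k lie in u, k+1, …, n-2 in d and n-1 is z
  covers′ : ∀ v → v < n → v ∈ u ++ z ∷ d
  covers′ v v<n with ℕP.<-cmp v (suc k)
  ... | tri< v<1+k _ _ = ∈-splice⁺ u d (inj₁ (hits (span U) z≤n v<1+k))
  ... | tri≈ _ refl _ = ∈-splice⁺ u d (inj₂ (inj₂ (hits (span D) ℕP.≤-refl (ℕP.m<m+n _ (s≤s z≤n)))))
  ... | tri> _ _ k<v with ℕP.<-cmp v z
  ...   | tri< v<z _ _ = ∈-splice⁺ u d (inj₂ (inj₂ (hits (span D) (ℕP.<⇒≤ k<v) v<z)))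
  ...   | tri≈ _ v≡z _ = ∈-splice⁺ u d (inj₂ (inj₁ v≡z))
  ...   | tri> _ _ z<v = ⊥-elim (ℕP.<-irrefl refl (ℕP.<-≤-trans v<n (subst (_≤ v) (sym (ℕP.+-suc (suc k) (suc r))) z<v)))

blocks : ℕ → ℕ → List (List ℕ)
blocks n j = zeroBlock n j ++ topBlock n j

block-index : ∀ m j → j ∈ range 1 m → ∃₂ λ i r → j ≡ suc i × suc (suc m) ≡ suc i + suc (suc r)
block-index m j j∈ with ∈-map⁻ (1 +_) j∈
... | i , i∈ , refl = i , r , refl , cong suc (trans (cong suc (sym (ℕP.m+[n∸m]≡n (∈-upTo⁻ i∈)))) (sym i+r+2≡))
  where
  r = m ∸ suc i
  i+r+2≡ : i + suc (suc r) ≡ suc (suc i + r)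
  i+r+2≡ = trans (ℕP.+-suc i (suc r)) (cong suc (ℕP.+-suc i r))

block-index⁺ : ∀ m i r → suc (suc m) ≡ suc i + suc (suc r) → suc i ∈ range 1 m
block-index⁺ m i r n≡ = ∈-map⁺ (1 +_) (∈-upTo⁺ (subst (i <_) (sym m≡) (ℕP.m<m+n i (s≤s z≤n))))
  where
  m≡ : m ≡ i + suc r
  m≡ = ℕP.suc-injective (trans (ℕP.suc-injective n≡) (ℕP.+-suc i (suc r)))

zeroBlock-at : ∀ i r → zeroBlock (suc i + suc (suc r)) (suc i) ≡ splices 0 (prefixRanged (suc (suc r)) (suc i)) (suffixRanged 1 (suc r))
zeroBlock-at i r rewrite ℕP.m+n∸m≡n (suc i) (suc (suc r)) = refl

topBlock-at : ∀ i r → topBlock (suc i + suc (suc r)) (suc i) ≡ splices (suc i + suc r) (prefixRanged 0 (suc i)) (suffixRanged (suc i) (suc r))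
topBlock-at i r rewrite ℕP.m+n∸m≡n (suc i) (suc (suc r)) | ℕP.+-suc i (suc r) = refl

blocks-isArcPerm : ∀ i r w → w ∈ blocks (suc i + suc (suc r)) (suc i) → IsArcPerm (suc i + suc (suc r)) w
blocks-isArcPerm i r w w∈ with ∈-++⁻ (zeroBlock (suc i + suc (suc r)) (suc i)) w∈
... | inj₁ w∈zero with ∈-splices⁻ 0 _ _ (subst (w ∈_) (zeroBlock-at i r) w∈zero)
...   | u , d , u∈ , d∈ , refl = zeroBlock-isArcPerm i r u d u∈ d∈
blocks-isArcPerm i r w w∈ | inj₂ w∈top with ∈-splices⁻ (suc i + suc r) _ _ (subst (w ∈_) (topBlock-at i r) w∈top)
...   | u , d , u∈ , d∈ , refl = topBlock-isArcPerm i r u d u∈ d∈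

arcList-sound : ∀ m w → w ∈ arcList (suc (suc m)) → IsArcPerm (suc (suc m)) w
arcList-sound m w w∈ with ∈-++⁻ (prefixRanged 0 (suc (suc m))) w∈
... | inj₁ w∈pr = prefixRanged-isArcPerm (suc m) w w∈pr
... | inj₂ w∈bl with find (∈-concatMap⁻ (blocks (suc (suc m))) {xs = range 1 m} w∈bl)
...   | j , j∈ , w∈j with block-index m j j∈
...     | i , r , refl , n≡ = subst (λ n → IsArcPerm n w) (sym n≡)
                                (blocks-isArcPerm i r w (subst (λ n → w ∈ blocks n (suc i)) n≡ w∈j))

interval⇒range : ∀ N p → IsInterval (suc N) p → (∀ {v} → v ∈ p → v < suc N) → 0 ∉ p ⊎ N ∉ p → ∃₂ λ a b → Spans p a b
interval⇒range N p (a , b , _ , b<n , _ , inj₁ seg) bounded _ = a , suc b , record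
  { bounds = λ v∈ → let a≤v , v≤b = proj₁ (seg _ (bounded v∈)) v∈ in a≤v , s≤s v≤b
  ; hits   = λ a≤v v<1+b → proj₂ (seg _ (ℕP.≤-trans v<1+b b<n)) (a≤v , ℕP.≤-pred v<1+b) }
interval⇒range N p (a , b , _ , b<n , _ , inj₂ wrap) _ (inj₁ 0∉p) = ⊥-elim (0∉p (proj₂ (wrap 0 (s≤s z≤n)) (inj₂ z≤n)))
interval⇒range N p (a , b , _ , b<n , _ , inj₂ wrap) _ (inj₂ N∉p) = ⊥-elim (N∉p (proj₂ (wrap N (ℕP.n<1+n N)) (inj₁ (ℕP.≤-pred b<n))))

complement-of-interval⇒range : ∀ N P q → IsInterval (suc N) P → 0 ∈ P → N ∈ P → Unique (P ++ q) →
  (∀ v → v < suc N → v ∈ P ++ q) → (∀ {v} → v ∈ q → v < suc N) → q ≢ [] → ∃₂ λ a b → Spans q a b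
complement-of-interval⇒range N P []      _ _ _ _ _ _ q≢[] = ⊥-elim (q≢[] refl)
complement-of-interval⇒range N P (y ∷ q) (a , b , _ , b<n , _ , inj₁ seg) 0∈P N∈P uniq _ bounded _ =
  -- a segment containing 0 and N is everything, leaving nothing for q
  ⊥-elim (disjoint (proj₂ (seg y (bounded (here refl))) (a≤0 , y≤b)) (here refl))
  where
  disjoint = proj₂ (proj₂ (unique-++⁻ P uniq))
  a≤0 : a ≤ y
  a≤0 = ℕP.≤-trans (proj₁ (proj₁ (seg 0 (s≤s z≤n)) 0∈P)) z≤n
  y≤b : y ≤ b
  y≤b = ℕP.≤-trans (ℕP.≤-pred (bounded (here refl))) (proj₂ (proj₁ (seg N (ℕP.n<1+n N)) N∈P))
complement-of-interval⇒range N P q (a , b , _ , b<n , _ , inj₂ wrap) 0∈P N∈P uniq covers bounded _ =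
  suc a , b , record { bounds = bounds′ ; hits = hits′ }
  where
  disjoint = proj₂ (proj₂ (unique-++⁻ P uniq))
  bounds′ : ∀ {v} → v ∈ q → suc a ≤ v × v < b
  bounds′ v∈q = ℕP.≰⇒> (λ v≤a → disjoint (proj₂ (wrap _ (bounded v∈q)) (inj₂ v≤a)) v∈q)
              , ℕP.≰⇒> (λ b≤v → disjoint (proj₂ (wrap _ (bounded v∈q)) (inj₁ b≤v)) v∈q)
  hits′ : ∀ {v} → suc a ≤ v → v < b → v ∈ q
  hits′ {v} a<v v<b with ∈-++⁻ P (covers v (ℕP.<-trans v<b b<n))
  ... | inj₂ v∈q = v∈q
  ... | inj₁ v∈P with proj₁ (wrap v (ℕP.<-trans v<b b<n)) v∈P
  ...   | inj₁ b≤v = ⊥-elim (ℕP.<-irrefl refl (ℕP.<-≤-trans v<b b≤v))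
  ...   | inj₂ v≤a = ⊥-elim (ℕP.<-irrefl refl (ℕP.<-≤-trans a<v v≤a))

zeroBlock∈arcList : ∀ m i r u d → suc (suc m) ≡ suc i + suc (suc r) →
  u ∈ prefixRanged (suc (suc r)) (suc i) → d ∈ suffixRanged 1 (suc r) → u ++ 0 ∷ d ∈ arcList (suc (suc m))
zeroBlock∈arcList m i r u d n≡ u∈ d∈ = ∈-++⁺ʳ (prefixRanged 0 (suc (suc m)))
  (∈-concatMap-intro (blocks (suc (suc m))) (block-index⁺ m i r n≡)
    (∈-++⁺ˡ (subst (λ n → u ++ 0 ∷ d ∈ zeroBlock n (suc i)) (sym n≡)
      (subst (u ++ 0 ∷ d ∈_) (sym (zeroBlock-at i r)) (∈-splices⁺ 0 _ _ u∈ d∈)))))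

topBlock∈arcList : ∀ m i r u d → suc (suc m) ≡ suc i + suc (suc r) →
  u ∈ prefixRanged 0 (suc i) → d ∈ suffixRanged (suc i) (suc r) → u ++ suc m ∷ d ∈ arcList (suc (suc m))
topBlock∈arcList m i r u d n≡ u∈ d∈ = ∈-++⁺ʳ (prefixRanged 0 (suc (suc m)))
  (∈-concatMap-intro (blocks (suc (suc m))) (block-index⁺ m i r n≡)
    (∈-++⁺ʳ (zeroBlock (suc (suc m)) (suc i)) (subst (λ n → u ++ (n ∸ 1) ∷ d ∈ topBlock n (suc i)) (sym n≡)
      (subst (λ z → u ++ z ∷ d ∈ topBlock (suc i + suc (suc r)) (suc i)) (sym (ℕP.+-suc i (suc r)))
        (subst (u ++ (suc i + suc r) ∷ d ∈_) (sym (topBlock-at i r)) (∈-splices⁺ (suc i + suc r) _ _ u∈ d∈))))))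

-- Completeness: every arc permutation of S_{m+2} occurs in arcList.  Write it as u z d where z is
-- whichever of 0 and N = m+1 comes second; the other extreme value lies in u.
module Completeness (m : ℕ) where
  N = suc m
  n = suc N

  -- The prefixes of u avoid z, so they are plain ranges: u is prefix-ranged.
  prefix-part : ∀ u z d → IsArcPerm n (u ++ z ∷ d) → z ≡ 0 ⊎ z ≡ N → ∀ k → length u ≡ suc k →
    ∃[ lo ] u ∈ prefixRanged lo (suc k)
  prefix-part u z d A z-extreme k len≡ = prefixRanged-complete k u len≡ (proj₁ (unique-++⁻ u unique)) range-prefix
    where
    open IsArcPerm A
    z∉u : z ∉ u
    z∉u z∈u = proj₂ (proj₂ (unique-++⁻ u unique)) z∈u (here refl)
    range-prefix : ∀ p q → u ≡ p ++ q → p ≢ [] → ∃₂ λ a b → Spans p a b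
    range-prefix p q e p≢[] = interval⇒range N p (intervals p (q ++ z ∷ d) w≡ p≢[])
      (λ v∈ → bounded (subst (_ ∈_) (sym w≡) (∈-++⁺ˡ v∈))) (avoid z-extreme)
      where
      w≡ : u ++ z ∷ d ≡ p ++ (q ++ z ∷ d)
      w≡ = trans (cong (_++ z ∷ d) e) (LP.++-assoc p q (z ∷ d))
      z∉p : z ∉ p
      z∉p z∈p = z∉u (subst (_ ∈_) (sym e) (∈-++⁺ˡ z∈p))
      avoid : z ≡ 0 ⊎ z ≡ N → 0 ∉ p ⊎ N ∉ p
      avoid (inj₁ refl) = inj₁ z∉p
      avoid (inj₂ refl) = inj₂ z∉p

  -- Once 0 and N have both been placed, each prefix is an interval containing both, so each
  -- suffix of d is a range: d is suffix-ranged.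
  suffix-part : ∀ u z d → IsArcPerm n (u ++ z ∷ d) → 0 ∈ u ++ z ∷ [] → N ∈ u ++ z ∷ [] →
    ∀ r → length d ≡ suc r → ∃[ lo ] d ∈ suffixRanged lo (suc r)
  suffix-part u z d A 0∈ N∈ r len≡ = suffixRanged-complete r d len≡ d-unique range-suffix
    where
    open IsArcPerm A
    d-unique : Unique d
    d-unique with proj₁ (proj₂ (unique-++⁻ u unique))
    ... | _ ∷ ud = ud
    extend : ∀ {x} p → x ∈ u ++ z ∷ [] → x ∈ u ++ z ∷ p
    extend p x∈ with ∈-++⁻ u x∈
    ... | inj₁ x∈u         = ∈-++⁺ˡ x∈u
    ... | inj₂ (here refl) = ∈-++⁺ʳ u (here refl)
    range-suffix : ∀ p q → d ≡ p ++ q → q ≢ [] → ∃₂ λ a b → Spans q a b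
    range-suffix p q e q≢[] = complement-of-interval⇒range N (u ++ z ∷ p) q
      (intervals (u ++ z ∷ p) q w≡ nonempty)
      (extend p 0∈) (extend p N∈) (subst Unique w≡ unique) (λ v v<n → subst (v ∈_) w≡ (covers v v<n))
      (λ v∈ → bounded (subst (_ ∈_) (sym w≡) (∈-++⁺ʳ (u ++ z ∷ p) v∈))) q≢[]
      where
      w≡ : u ++ z ∷ d ≡ (u ++ z ∷ p) ++ q
      w≡ = trans (cong (λ t → u ++ z ∷ t) e) (sym (LP.++-assoc u (z ∷ p) q))
      nonempty : u ++ z ∷ p ≢ []
      nonempty e′ = ∷ʳ≢[] u z (LP.++-conicalˡ (u ∷ʳ z) p (trans (LP.++-assoc u (z ∷ []) p) e′))

  range-reaches-top : ∀ {u lo k} → Spans u lo (lo + suc k) → N ∈ u → (∀ {v} → v ∈ u → v < n) → lo + suc k ≡ n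
  range-reaches-top {lo = lo} {k} sp N∈u bounded =
    ℕP.≤-antisym (subst (_≤ n) (sym (ℕP.+-suc lo k)) (bounded (spans-max sp))) (proj₂ (bounds sp N∈u))

  ≤1⇒≡1 : ∀ a → a ≤ 1 → a ≢ 0 → a ≡ 1
  ≤1⇒≡1 zero          _         a≢0 = ⊥-elim (a≢0 refl)
  ≤1⇒≡1 (suc zero)    _         _   = refl
  ≤1⇒≡1 (suc (suc _)) (s≤s ()) _

  -- 0 is placed after N: u (containing N) is the range lo, …, n-1 and d the range 1, …, lo-1.
  zero-second : ∀ u k lo d → u ∈ prefixRanged lo (suc k) → IsArcPerm n (u ++ 0 ∷ d) → N ∈ u →
    u ++ 0 ∷ d ∈ arcList n
  zero-second u k lo [] u∈ A N∈u = ∈-++⁺ˡ (∈-++⁺ʳ (map (_∷ʳ (0 + suc m)) (prefixRanged 0 (suc m)))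
                                      (∈-map⁺ (_∷ʳ 0) (subst₂ (λ a b → u ∈ prefixRanged a (suc b)) lo≡1 k≡m u∈)))
    where
    open IsArcPerm A
    U = prefixRanged-arrangement lo k u u∈
    k≡m : k ≡ m
    k≡m = ℕP.suc-injective (ℕP.suc-injective (trans (trans (cong suc (sym (len U))) (sym (length-∷ʳ u 0))) length≡))
    lo≡1 : lo ≡ 1
    lo≡1 = ℕP.+-cancelʳ-≡ (suc k) lo 1 (trans (range-reaches-top (span U) N∈u (λ v∈ → bounded (∈-++⁺ˡ v∈)))
                                                (cong (suc ∘ suc) (sym k≡m)))
  zero-second u k lo (y ∷ d′) u∈ A N∈u with suffix-part u 0 (y ∷ d′) A (∈-++⁺ʳ u (here refl)) (∈-++⁺ˡ N∈u) (length d′) refl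
  ... | lo′ , d∈ = zeroBlock∈arcList m k r u (y ∷ d′) (sym n≡)
                     (subst (λ a → u ∈ prefixRanged a (suc k)) lo≡ u∈)
                     (subst (λ a → y ∷ d′ ∈ suffixRanged a (suc r)) lo′≡1 d∈)
    where
    open IsArcPerm A
    r = length d′
    U = prefixRanged-arrangement lo k u u∈
    D = suffixRanged-arrangement lo′ r (y ∷ d′) d∈
    disjoint = proj₂ (proj₂ (unique-++⁻ u unique))
    n≡ : suc k + suc (suc r) ≡ n
    n≡ = trans (trans (cong₂ _+_ (sym (len U)) refl) (sym (LP.length-++ u))) length≡
    top≡ : lo + suc k ≡ n
    top≡ = range-reaches-top (span U) N∈u (λ v∈ → bounded (∈-++⁺ˡ v∈))
    lo≡ : lo ≡ suc (suc r)
    lo≡ = ℕP.+-cancelʳ-≡ (suc k) lo (suc (suc r)) (trans top≡ (trans (sym n≡) (ℕP.+-comm (suc k) (suc (suc r)))))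
    -- d starts at 1: its least element is not 0, and its largest lies below u
    lo′≢0 : lo′ ≢ 0
    lo′≢0 refl with unique-++⁻ u unique
    ... | _ , 0∉d ∷ _ , _ = All.lookup 0∉d (spans-min (span D)) refl
    max<lo : lo′ + r < lo
    max<lo = ℕP.≰⇒> (λ lo≤max → disjoint (hits (span U) lo≤max (subst (lo′ + r <_) (sym top≡)
               (bounded (∈-++⁺ʳ u (there (spans-max (span D))))))) (there (spans-max (span D))))
    lo′≡1 : lo′ ≡ 1
    lo′≡1 = ≤1⇒≡1 lo′ (ℕP.+-cancelʳ-≤ r lo′ 1 (ℕP.≤-pred (subst (lo′ + r <_) lo≡ max<lo))) lo′≢0

  prefixRanged-from-0 : ∀ u k lo → u ∈ prefixRanged lo (suc k) → 0 ∈ u → u ∈ prefixRanged 0 (suc k)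
  prefixRanged-from-0 u k lo u∈ 0∈u =
    subst (λ a → u ∈ prefixRanged a (suc k)) (ℕP.n≤0⇒n≡0 (proj₁ (bounds (span (prefixRanged-arrangement lo k u u∈)) 0∈u))) u∈

  -- N is placed after 0: u (containing 0) is the range 0, …, k and d the range k+1, …, N-1.
  top-second : ∀ u k d → u ∈ prefixRanged 0 (suc k) → IsArcPerm n (u ++ N ∷ d) → 0 ∈ u → u ++ N ∷ d ∈ arcList n
  top-second u k [] u∈ A 0∈u = ∈-++⁺ˡ (∈-++⁺ˡ (∈-map⁺ (_∷ʳ (0 + suc m)) (subst (λ b → u ∈ prefixRanged 0 (suc b)) k≡m u∈)))
    where
    open IsArcPerm A
    k≡m : k ≡ m
    k≡m = ℕP.suc-injective (ℕP.suc-injective (trans (trans (cong suc (sym (len (prefixRanged-arrangement 0 k u u∈))))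
                                                            (sym (length-∷ʳ u N))) length≡))
  top-second u k (y ∷ d′) u∈ A 0∈u with suffix-part u N (y ∷ d′) A (∈-++⁺ˡ 0∈u) (∈-++⁺ʳ u (here refl)) (length d′) refl
  ... | lo′ , d∈ = topBlock∈arcList m k r u (y ∷ d′) (sym n≡) u∈
                     (subst (λ a → y ∷ d′ ∈ suffixRanged a (suc r)) (ℕP.≤-antisym lo′≤ ≤lo′) d∈)
    where
    open IsArcPerm A
    r = length d′
    U = prefixRanged-arrangement 0 k u u∈
    D = suffixRanged-arrangement lo′ r (y ∷ d′) d∈
    disjoint = proj₂ (proj₂ (unique-++⁻ u unique))
    n≡ : suc k + suc (suc r) ≡ n
    n≡ = trans (trans (cong₂ _+_ (sym (len U)) refl) (sym (LP.length-++ u))) length≡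
    -- d lies above u, and its largest element lies below N
    ≤lo′ : suc k ≤ lo′
    ≤lo′ = ℕP.≮⇒≥ (λ lo′<1+k → disjoint (hits (span U) z≤n lo′<1+k) (there (spans-min (span D))))
    N∉d : N ∉ y ∷ d′
    N∉d N∈d with unique-++⁻ u unique
    ... | _ , N∉ ∷ _ , _ = All.lookup N∉ N∈d refl
    max<N : lo′ + r < N
    max<N = ℕP.≤∧≢⇒< (ℕP.≤-pred (bounded (∈-++⁺ʳ u (there (spans-max (span D))))))
                      (λ max≡N → N∉d (subst (_∈ y ∷ d′) max≡N (spans-max (span D))))
    N≡ : N ≡ suc (suc k + r)
    N≡ = trans (ℕP.suc-injective (sym n≡)) (trans (ℕP.+-suc k (suc r)) (cong suc (ℕP.+-suc k r)))
    lo′≤ : lo′ ≤ suc k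
    lo′≤ = ℕP.+-cancelʳ-≤ r lo′ (suc k) (ℕP.≤-pred (subst (lo′ + r <_) N≡ max<N))

  length-pos : ∀ {x} {u : List ℕ} → x ∈ u → ∃[ k ] length u ≡ suc k
  length-pos {u = _ ∷ u} _ = length u , refl

  -- Cut w at its 0 and look where N lies.
  arcList-complete : ∀ w → IsArcPerm n w → w ∈ arcList n
  arcList-complete w A with ∈-∃++ (IsArcPerm.covers A 0 (s≤s z≤n))
  ... | p₀ , s₀ , refl with ∈-++⁻ p₀ (IsArcPerm.covers A N (ℕP.n<1+n N))
  ...   | inj₁ N∈p₀ with length-pos N∈p₀
  ...     | k , len≡ with prefix-part p₀ 0 s₀ A (inj₁ refl) k len≡
  ...       | lo , u∈ = zero-second p₀ k lo s₀ u∈ A N∈p₀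
  arcList-complete w A | p₀ , s₀ , refl | inj₂ (there N∈s₀) with ∈-∃++ N∈s₀
  ...   | q , d , refl with prefix-part (p₀ ++ 0 ∷ q) N d A′ (inj₂ refl) (length p₀ + length q) len≡
    where
    A′ : IsArcPerm n ((p₀ ++ 0 ∷ q) ++ N ∷ d)
    A′ = subst (IsArcPerm n) (sym (LP.++-assoc p₀ (0 ∷ q) (N ∷ d))) A
    len≡ : length (p₀ ++ 0 ∷ q) ≡ suc (length p₀ + length q)
    len≡ = trans (LP.length-++-sucʳ p₀ 0 q) (cong suc (LP.length-++ p₀))
  ...     | lo , u∈ = subst (_∈ arcList n) (LP.++-assoc p₀ (0 ∷ q) (N ∷ d))
                        (top-second u (length p₀ + length q) d (prefixRanged-from-0 u (length p₀ + length q) lo u∈ 0∈u)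
                           (subst (IsArcPerm n) (sym (LP.++-assoc p₀ (0 ∷ q) (N ∷ d))) A) 0∈u)
    where
    u = p₀ ++ 0 ∷ q
    0∈u : 0 ∈ u
    0∈u = ∈-++⁺ʳ p₀ (here refl)

prefixRanged-length : ∀ lo j u → u ∈ prefixRanged lo j → length u ≡ j
prefixRanged-length lo zero    u (here refl) = refl
prefixRanged-length lo (suc j) u u∈          = len (prefixRanged-arrangement lo j u u∈)

prefixRanged-unique : ∀ lo j → Unique (prefixRanged lo j)
prefixRanged-unique lo zero          = [] ∷ []
prefixRanged-unique lo (suc zero)    = [] ∷ []
prefixRanged-unique lo (suc (suc m)) =
  unique-++⁺ (Uniq.map⁺ (LP.∷ʳ-injectiveˡ _ _) (prefixRanged-unique lo (suc m)))
             (Uniq.map⁺ (LP.∷ʳ-injectiveˡ _ _) (prefixRanged-unique (suc lo) (suc m))) different-last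
  where
  different-last : ∀ {w} → w ∈ map (_∷ʳ (lo + suc m)) (prefixRanged lo (suc m)) → w ∉ map (_∷ʳ lo) (prefixRanged (suc lo) (suc m))
  different-last w∈₁ w∈₂ with ∈-map⁻ (_∷ʳ (lo + suc m)) w∈₁ | ∈-map⁻ (_∷ʳ lo) w∈₂
  ... | a , _ , refl | b , _ , e = ℕP.<-irrefl (sym (LP.∷ʳ-injectiveʳ a b e)) (ℕP.m<m+n lo (s≤s z≤n))

suffixRanged-unique : ∀ lo j → Unique (suffixRanged lo j)
suffixRanged-unique lo zero          = [] ∷ []
suffixRanged-unique lo (suc zero)    = [] ∷ []
suffixRanged-unique lo (suc (suc m)) =
  unique-++⁺ (Uniq.map⁺ (λ { refl → refl }) (suffixRanged-unique (suc lo) (suc m)))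
             (Uniq.map⁺ (λ { refl → refl }) (suffixRanged-unique lo (suc m))) different-first
  where
  different-first : ∀ {w} → w ∈ map (lo ∷_) (suffixRanged (suc lo) (suc m)) → w ∉ map ((lo + suc m) ∷_) (suffixRanged lo (suc m))
  different-first w∈₁ w∈₂ with ∈-map⁻ (lo ∷_) w∈₁ | ∈-map⁻ ((lo + suc m) ∷_) w∈₂
  ... | a , _ , refl | b , _ , e = ℕP.<-irrefl (proj₁ (LP.∷-injective e)) (ℕP.m<m+n lo (s≤s z≤n))

-- u z d determines u when all u have the same length j.
splices-unique : ∀ z j Us Ds → Unique Us → Unique Ds → (∀ {u} → u ∈ Us → length u ≡ j) → Unique (splices z Us Ds)
splices-unique z j Us Ds uUs uDs lengths =
  unique-concatMap (λ u → map (λ d → u ++ z ∷ d) Ds) (take j) Us uUs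
    (λ {u} _ → Uniq.map⁺ (λ e → proj₂ (LP.∷-injective (LP.++-cancelˡ u _ _ e))) uDs)
    (λ {u} u∈ a∈ → let d , _ , a≡ = ∈-map⁻ (λ d → u ++ z ∷ d) a∈ in
       trans (cong (take j) a≡) (subst (λ k → take k (u ++ z ∷ d) ≡ u) (lengths u∈) (take-length-++ u (z ∷ d))))

position : ℕ → List ℕ → ℕ
position v []      = 0
position v (a ∷ w) with v ℕP.≟ a
... | yes _ = 0
... | no  _ = suc (position v w)

position-hit : ∀ v (u : List ℕ) d → v ∉ u → position v (u ++ v ∷ d) ≡ length u
position-hit v []      d v∉ with v ℕP.≟ v
... | yes _   = refl
... | no v≢v = ⊥-elim (v≢v refl)
position-hit v (a ∷ u) d v∉ with v ℕP.≟ a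
... | yes refl = ⊥-elim (v∉ (here refl))
... | no  _    = cong suc (position-hit v u d (λ v∈ → v∉ (there v∈)))

position-early : ∀ v (u : List ℕ) r → v ∈ u → position v (u ++ r) < length u
position-early v (a ∷ u) r v∈ with v ℕP.≟ a
... | yes _ = s≤s z≤n
position-early v (a ∷ u) r (here v≡a)  | no v≢a = ⊥-elim (v≢a v≡a)
position-early v (a ∷ u) r (there v∈u) | no _   = s≤s (position-early v u r v∈u)

-- The number of letters before whichever of 0 and N comes second; it identifies the block of w.
blockKey : ℕ → List ℕ → ℕ
blockKey N w = position 0 w ⊔ position N w

blockKey-zero : ∀ N (u : List ℕ) d → 0 ∉ u → N ∈ u → blockKey N (u ++ 0 ∷ d) ≡ length u
blockKey-zero N u d 0∉u N∈u = trans (cong (_⊔ position N (u ++ 0 ∷ d)) (position-hit 0 u d 0∉u))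
                                    (ℕP.m≥n⇒m⊔n≡m (ℕP.<⇒≤ (position-early N u (0 ∷ d) N∈u)))

blockKey-top : ∀ N (u : List ℕ) d → N ∉ u → 0 ∈ u → blockKey N (u ++ N ∷ d) ≡ length u
blockKey-top N u d N∉u 0∈u = trans (cong (position 0 (u ++ N ∷ d) ⊔_) (position-hit N u d N∉u))
                                   (ℕP.m≤n⇒m⊔n≡n (ℕP.<⇒≤ (position-early 0 u (N ∷ d) 0∈u)))

blocks-key : ∀ i r w → w ∈ blocks (suc i + suc (suc r)) (suc i) → blockKey (suc i + suc r) w ≡ suc i
blocks-key i r w w∈ with ∈-++⁻ (zeroBlock (suc i + suc (suc r)) (suc i)) w∈
... | inj₁ w∈zero with ∈-splices⁻ 0 _ _ (subst (w ∈_) (zeroBlock-at i r) w∈zero)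
...   | u , d , u∈ , _ , refl = trans (blockKey-zero _ u d 0∉u N∈u) (len U)
  where
  U = prefixRanged-arrangement (suc (suc r)) i u u∈
  0∉u : 0 ∉ u
  0∉u 0∈u with proj₁ (bounds (span U) 0∈u)
  ... | ()
  N∈u : suc i + suc r ∈ u
  N∈u = subst (_∈ u) (trans (ℕP.+-comm (suc (suc r)) i) (ℕP.+-suc i (suc r))) (spans-max (span U))
blocks-key i r w w∈ | inj₂ w∈top with ∈-splices⁻ (suc i + suc r) _ _ (subst (w ∈_) (topBlock-at i r) w∈top)
...   | u , d , u∈ , _ , refl = trans (blockKey-top _ u d N∉u (spans-min (span U))) (len U)
  where
  U = prefixRanged-arrangement 0 i u u∈
  N∉u : suc i + suc r ∉ u
  N∉u N∈u = ℕP.<-irrefl refl (ℕP.<-≤-trans (proj₂ (bounds (span U) N∈u)) (ℕP.m≤m+n (suc i) (suc r)))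

-- A block is duplicate-free: the letter at position i+1 tells its two halves apart.
blocks-unique : ∀ i r → Unique (blocks (suc i + suc (suc r)) (suc i))
blocks-unique i r rewrite zeroBlock-at i r | topBlock-at i r =
  unique-++⁺ (splices-unique 0 (suc i) (prefixRanged (suc (suc r)) (suc i)) (suffixRanged 1 (suc r))
               (prefixRanged-unique (suc (suc r)) (suc i)) (suffixRanged-unique 1 (suc r)) (prefixRanged-length _ _ _))
             (splices-unique (suc i + suc r) (suc i) (prefixRanged 0 (suc i)) (suffixRanged (suc i) (suc r))
               (prefixRanged-unique 0 (suc i)) (suffixRanged-unique (suc i) (suc r)) (prefixRanged-length _ _ _))
             different-middle
  where
  middle : ∀ (u u′ d d′ : List ℕ) a b → u ++ a ∷ d ≡ u′ ++ b ∷ d′ → length u ≡ length u′ → a ≡ b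
  middle []      []       d d′ a b e _ = proj₁ (LP.∷-injective e)
  middle (x ∷ u) (y ∷ u′) d d′ a b e l = middle u u′ d d′ a b (proj₂ (LP.∷-injective e)) (ℕP.suc-injective l)
  different-middle : ∀ {w} → w ∈ splices 0 (prefixRanged (suc (suc r)) (suc i)) (suffixRanged 1 (suc r)) →
    w ∉ splices (suc i + suc r) (prefixRanged 0 (suc i)) (suffixRanged (suc i) (suc r))
  different-middle w∈₁ w∈₂ with ∈-splices⁻ 0 (prefixRanged (suc (suc r)) (suc i)) (suffixRanged 1 (suc r)) w∈₁
                               | ∈-splices⁻ (suc i + suc r) (prefixRanged 0 (suc i)) (suffixRanged (suc i) (suc r)) w∈₂
  ... | u , d , u∈ , _ , refl | u′ , d′ , u′∈ , _ , e
    with middle u u′ d d′ 0 (suc i + suc r) e (trans (prefixRanged-length _ (suc i) u u∈) (sym (prefixRanged-length 0 (suc i) u′ u′∈)))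
  ... | ()

prefixRanged-key : ∀ m w → w ∈ prefixRanged 0 (suc (suc m)) → blockKey (suc m) w ≡ suc m
prefixRanged-key m w w∈ with ∈-++⁻ (map (_∷ʳ (0 + suc m)) (prefixRanged 0 (suc m))) w∈
... | inj₁ w∈top with ∈-map⁻ (_∷ʳ (0 + suc m)) w∈top
...   | u , u∈ , refl = trans (blockKey-top (suc m) u [] (top∉ (span U)) (spans-min (span U))) (len U)
  where U = prefixRanged-arrangement 0 m u u∈
prefixRanged-key m w w∈ | inj₂ w∈bot with ∈-map⁻ (_∷ʳ 0) w∈bot
...   | u , u∈ , refl = trans (blockKey-zero (suc m) u [] (bottom∉ (span U)) (spans-max (span U))) (len U)
  where U = prefixRanged-arrangement 1 m u u∈

arcList-unique : ∀ m → Unique (arcList (suc (suc m)))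
arcList-unique m = unique-++⁺ (prefixRanged-unique 0 n)
  (unique-concatMap (blocks n) (blockKey (suc m)) (range 1 m) (Uniq.map⁺ ℕP.suc-injective (Uniq.upTo⁺ m))
    block-unique key)
  different-keys
  where
  n = suc (suc m)
  block-unique : ∀ {j} → j ∈ range 1 m → Unique (blocks n j)
  block-unique j∈ with block-index m _ j∈
  ... | i , r , refl , n≡ = subst (λ k → Unique (blocks k (suc i))) (sym n≡) (blocks-unique i r)
  key : ∀ {j w} → j ∈ range 1 m → w ∈ blocks n j → blockKey (suc m) w ≡ j
  key {w = w} j∈ w∈ with block-index m _ j∈
  ... | i , r , refl , n≡ = subst (λ N → blockKey N w ≡ suc i) (sym N≡)
                              (blocks-key i r w (subst (λ k → w ∈ blocks k (suc i)) n≡ w∈))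
    where
    N≡ : suc m ≡ suc i + suc r
    N≡ = trans (ℕP.suc-injective n≡) (ℕP.+-suc i (suc r))
  different-keys : ∀ {w} → w ∈ prefixRanged 0 n → w ∉ concatMap (blocks n) (range 1 m)
  different-keys {w} w∈₁ w∈₂ with find (∈-concatMap⁻ (blocks n) {xs = range 1 m} w∈₂)
  ... | j , j∈ , w∈j with ∈-map⁻ (1 +_) j∈
  ...   | i , i∈ , refl = ℕP.<-irrefl (trans (sym (key j∈ w∈j)) (prefixRanged-key m w w∈₁)) (s≤s (∈-upTo⁻ i∈))

<ᵇ-true : ∀ {b a} → b < a → (b <ᵇ a) ≡ true
<ᵇ-true b<a = to T-≡ (ℕP.<⇒<ᵇ b<a)

<ᵇ-false : ∀ {b a} → a ≤ b → (b <ᵇ a) ≡ false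
<ᵇ-false {b} {a} a≤b with b <ᵇ a in e
... | false = refl
... | true  = ⊥-elim (ℕP.<-irrefl refl (ℕP.<-≤-trans (ℕP.<ᵇ⇒< b a (from T-≡ e)) a≤b))

cross : List ℕ → List ℕ → ℕ
cross []      v = 0
cross (a ∷ u) v = countᵇ (_<ᵇ a) v + cross u v

countᵇ-++ : ∀ p (u v : List ℕ) → countᵇ p (u ++ v) ≡ countᵇ p u + countᵇ p v
countᵇ-++ p []      v = refl
countᵇ-++ p (a ∷ u) v = trans (cong ((if p a then 1 else 0) +_) (countᵇ-++ p u v)) (sym (ℕP.+-assoc (if p a then 1 else 0) _ _))

inv-++ : ∀ (u v : List ℕ) → inv (u ++ v) ≡ inv u + (cross u v + inv v)
inv-++ []      v = refl
inv-++ (a ∷ u) v = begin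
  countᵇ (_<ᵇ a) (u ++ v) + inv (u ++ v)
    ≡⟨ cong₂ _+_ (countᵇ-++ (_<ᵇ a) u v) (inv-++ u v) ⟩
  (countᵇ (_<ᵇ a) u + countᵇ (_<ᵇ a) v) + (inv u + (cross u v + inv v))
    ≡⟨ regroup (countᵇ (_<ᵇ a) u) (countᵇ (_<ᵇ a) v) (inv u) (cross u v) (inv v) ⟩
  (countᵇ (_<ᵇ a) u + inv u) + ((countᵇ (_<ᵇ a) v + cross u v) + inv v) ∎
  where
  open ≡-Reasoning
  regroup : ∀ A B C D E → (A + B) + (C + (D + E)) ≡ (A + C) + ((B + D) + E)
  regroup = solve-∀

countᵇ-all : ∀ a (v : List ℕ) → (∀ {b} → b ∈ v → b < a) → countᵇ (_<ᵇ a) v ≡ length v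
countᵇ-all a []      _ = refl
countᵇ-all a (b ∷ v) below rewrite <ᵇ-true (below (here refl)) = cong suc (countᵇ-all a v (λ b∈ → below (there b∈)))

countᵇ-none : ∀ a (v : List ℕ) → (∀ {b} → b ∈ v → a ≤ b) → countᵇ (_<ᵇ a) v ≡ 0
countᵇ-none a []      _ = refl
countᵇ-none a (b ∷ v) above rewrite <ᵇ-false (above (here refl)) = countᵇ-none a v (λ b∈ → above (there b∈))

cross-all : ∀ (u v : List ℕ) → (∀ {a b} → a ∈ u → b ∈ v → b < a) → cross u v ≡ length u * length v
cross-all []      v _   = refl
cross-all (a ∷ u) v u>v = cong₂ _+_ (countᵇ-all a v (u>v (here refl))) (cross-all u v (λ a∈ → u>v (there a∈)))

cross-none : ∀ (u v : List ℕ) → (∀ {a b} → a ∈ u → b ∈ v → a ≤ b) → cross u v ≡ 0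
cross-none []      v _   = refl
cross-none (a ∷ u) v u≤v = cong₂ _+_ (countᵇ-none a v (u≤v (here refl))) (cross-none u v (λ a∈ → u≤v (there a∈)))

shift-upTo : ∀ p K → map (p +_) (upTo (suc K)) ≡ p + 0 ∷ map (suc p +_) (upTo K)
shift-upTo p K = cong (p + 0 ∷_) (trans (cong (map (p +_)) (sym (LP.map-upTo suc K)))
                                  (trans (sym (LP.map-∘ (upTo K))) (LP.map-cong (ℕP.+-suc p) (upTo K))))

module Weights {c ℓ : Level} (R : CommutativeSemiring c ℓ) (t : CommutativeSemiring.Carrier R)
               (x : ℕ → CommutativeSemiring.Carrier R) where
  open CommutativeSemiring R using (Carrier; _≈_; 0#; 1#; setoid; isEquivalence; +-isCommutativeMonoid;
    *-commutativeSemigroup; +-cong; +-congˡ; +-congʳ; *-cong; *-congˡ; *-congʳ; +-assoc; *-assoc;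
    +-identityˡ; +-identityʳ; *-identityˡ; *-identityʳ; distribˡ; distribʳ; zeroˡ; zeroʳ)
    renaming (_+_ to _⊕_; _*_ to _⊗_; refl to ≈-refl; sym to ≈-sym; trans to ≈-trans; reflexive to ≈-reflexive)
  open Poly R
  open import Relation.Binary.Reasoning.Setoid setoid
  open import Algebra.Properties.CommutativeSemigroup *-commutativeSemigroup using (interchange; x∙yz≈y∙xz)
  open import Data.List.Relation.Binary.Permutation.Propositional using (↭⇒↭ₛ′)
  open import Data.List.Relation.Binary.Permutation.Setoid.Properties setoid using (foldr-commMonoid)
  open import Algebra.Solver.CommutativeMonoid (CommutativeSemiring.*-commutativeMonoid R) using (var; prove)
    renaming (_⊕_ to _·_)
  open import Data.Fin.Patterns using (0F; 1F; 2F; 3F; 4F; 5F; 6F)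
  open import Data.Vec using () renaming ([] to []ᵛ; _∷_ to _∷ᵛ_)

  pow-+ : ∀ a b → pow t (a + b) ≈ pow t a ⊗ pow t b
  pow-+ zero    b = ≈-sym (*-identityˡ _)
  pow-+ (suc a) b = ≈-trans (*-congˡ (pow-+ a b)) (≈-sym (*-assoc t (pow t a) (pow t b)))

  sumL-++ : ∀ (as bs : List Carrier) → sumL (as ++ bs) ≈ sumL as ⊕ sumL bs
  sumL-++ []       bs = ≈-sym (+-identityˡ _)
  sumL-++ (a ∷ as) bs = ≈-trans (+-congˡ (sumL-++ as bs)) (≈-sym (+-assoc _ _ _))

  sum-map-++ : {A : Set} (f : A → Carrier) (as bs : List A) → sumL (map f (as ++ bs)) ≈ sumL (map f as) ⊕ sumL (map f bs)
  sum-map-++ f as bs = ≈-trans (≈-reflexive (cong sumL (LP.map-++ f as bs))) (sumL-++ (map f as) (map f bs))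

  sum-cong : {A : Set} (f g : A → Carrier) (as : List A) → (∀ {a} → a ∈ as → f a ≈ g a) → sumL (map f as) ≈ sumL (map g as)
  sum-cong f g []       _   = ≈-refl
  sum-cong f g (a ∷ as) f≈g = +-cong (f≈g (here refl)) (sum-cong f g as (λ a∈ → f≈g (there a∈)))

  sum-*ʳ : {A : Set} (f : A → Carrier) (c : Carrier) (as : List A) → sumL (map (λ a → f a ⊗ c) as) ≈ sumL (map f as) ⊗ c
  sum-*ʳ f c []       = ≈-sym (zeroˡ c)
  sum-*ʳ f c (a ∷ as) = ≈-trans (+-congˡ (sum-*ʳ f c as)) (≈-sym (distribʳ c (f a) _))

  sum-*ˡ : {A : Set} (f : A → Carrier) (c : Carrier) (as : List A) → sumL (map (λ a → c ⊗ f a) as) ≈ c ⊗ sumL (map f as)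
  sum-*ˡ f c []       = ≈-sym (zeroʳ c)
  sum-*ˡ f c (a ∷ as) = ≈-trans (+-congˡ (sum-*ˡ f c as)) (≈-sym (distribˡ c (f a) _))

  sum-concatMap : {A B : Set} (f : B → Carrier) (F : A → List B) (as : List A) →
    sumL (map f (concatMap F as)) ≈ sumL (map (λ a → sumL (map f (F a))) as)
  sum-concatMap f F []       = ≈-refl
  sum-concatMap f F (a ∷ as) = ≈-trans (sum-map-++ f (F a) (concatMap F as)) (+-congˡ (sum-concatMap f F as))

  sum-map-∘ : {A B : Set} (f : B → Carrier) (g : A → B) (as : List A) → sumL (map f (map g as)) ≈ sumL (map (f ∘ g) as)
  sum-map-∘ f g as = ≈-reflexive (cong sumL (sym (LP.map-∘ as)))

  sumL-↭ : ∀ {as bs : List Carrier} → as ↭ bs → sumL as ≈ sumL bs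
  sumL-↭ p = foldr-commMonoid +-isCommutativeMonoid (↭⇒↭ₛ′ isEquivalence p)

  wt : ℕ → List ℕ → Carrier
  wt p w = pow t (inv w) ⊗ xDesFrom x p w

  descentAt : ℕ → ℕ → ℕ → Carrier
  descentAt b l k = if b <ᵇ l then x k else 1#

  ascent : ∀ {b l} k → l ≤ b → descentAt b l k ≈ 1#
  ascent k l≤b rewrite <ᵇ-false l≤b = ≈-refl

  descent : ∀ {b l} k → b < l → descentAt b l k ≈ x k
  descent k b<l rewrite <ᵇ-true b<l = ≈-refl

  lastOf : ℕ → List ℕ → ℕ
  lastOf a []      = a
  lastOf a (c ∷ u) = lastOf c u

  lastOf∈ : ∀ a u → lastOf a u ∈ a ∷ u
  lastOf∈ a []      = here refl
  lastOf∈ a (c ∷ u) = there (lastOf∈ c u)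

  xDes-++ : ∀ i a u b v → xDesFrom x i ((a ∷ u) ++ b ∷ v) ≈
    xDesFrom x i (a ∷ u) ⊗ (descentAt b (lastOf a u) (i + length u) ⊗ xDesFrom x (suc (i + length u)) (b ∷ v))
  xDes-++ i a []      b v rewrite ℕP.+-identityʳ i = ≈-sym (*-identityˡ _)
  xDes-++ i a (c ∷ u) b v rewrite ℕP.+-suc i (length u) =
    ≈-trans (*-congˡ (xDes-++ (suc i) c u b v)) (≈-sym (*-assoc _ _ _))

  -- ∏_{i=1}^{k} (1 + t^i x_i), the generating polynomial of prefix-ranged words of length k+1 …
  prefixPoly : ℕ → Carrier
  prefixPoly zero    = 1#
  prefixPoly (suc k) = prefixPoly k ⊗ (1# ⊕ pow t (suc k) ⊗ x (suc k))

  -- … and ∏_{q<r} (1 + t^{r-q} x_{p+q}), that of suffix-ranged words of length r+1 with positions from p.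
  suffixPoly : ℕ → ℕ → Carrier
  suffixPoly p zero    = 1#
  suffixPoly p (suc r) = (1# ⊕ pow t (suc r) ⊗ x p) ⊗ suffixPoly (suc p) r

  -- Appending the new maximum creates no inversion and no descent …
  wt-∷ʳtop : ∀ lo k u → u ∈ prefixRanged lo (suc k) → wt 1 (u ∷ʳ (lo + suc k)) ≈ wt 1 u
  wt-∷ʳtop lo k u u∈ with prefixRanged-arrangement lo k u u∈
  wt-∷ʳtop lo k (a ∷ u′) u∈ | U = begin
    pow t (inv ((a ∷ u′) ++ top ∷ [])) ⊗ xDesFrom x 1 ((a ∷ u′) ++ top ∷ [])
      ≈⟨ *-cong (≈-reflexive (cong (pow t) inv≡)) (xDes-++ 1 a u′ top []) ⟩
    pow t (inv (a ∷ u′)) ⊗ (xDesFrom x 1 (a ∷ u′) ⊗ (descentAt top (lastOf a u′) (1 + length u′) ⊗ 1#))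
      ≈⟨ *-congˡ (*-congˡ (≈-trans (*-identityʳ _) (ascent _ (ℕP.<⇒≤ (proj₂ (bounds (span U) (lastOf∈ a u′))))))) ⟩
    pow t (inv (a ∷ u′)) ⊗ (xDesFrom x 1 (a ∷ u′) ⊗ 1#)
      ≈⟨ *-congˡ (*-identityʳ _) ⟩
    wt 1 (a ∷ u′) ∎
    where
    top = lo + suc k
    inv≡ : inv ((a ∷ u′) ++ top ∷ []) ≡ inv (a ∷ u′)
    inv≡ = trans (inv-++ (a ∷ u′) (top ∷ []))
             (trans (cong (λ z → inv (a ∷ u′) + (z + 0)) (cross-none (a ∷ u′) (top ∷ [])
                      (λ { a∈ (here refl) → ℕP.<⇒≤ (proj₂ (bounds (span U) a∈)) })))
                    (ℕP.+-identityʳ _))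

  -- … appending the new minimum creates k+1 inversions and a descent at position k+1.
  wt-∷ʳbottom : ∀ lo k u → u ∈ prefixRanged (suc lo) (suc k) → wt 1 (u ∷ʳ lo) ≈ wt 1 u ⊗ (pow t (suc k) ⊗ x (suc k))
  wt-∷ʳbottom lo k u u∈ with prefixRanged-arrangement (suc lo) k u u∈
  wt-∷ʳbottom lo k (a ∷ u′) u∈ | U = begin
    pow t (inv ((a ∷ u′) ++ lo ∷ [])) ⊗ xDesFrom x 1 ((a ∷ u′) ++ lo ∷ [])
      ≈⟨ *-cong (≈-trans (≈-reflexive (cong (pow t) inv≡)) (pow-+ (inv (a ∷ u′)) (suc k))) (xDes-++ 1 a u′ lo []) ⟩
    (pow t (inv (a ∷ u′)) ⊗ pow t (suc k)) ⊗ (xDesFrom x 1 (a ∷ u′) ⊗ (descentAt lo (lastOf a u′) (1 + length u′) ⊗ 1#))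
      ≈⟨ *-congˡ (*-congˡ (≈-trans (*-identityʳ _) (≈-trans (descent _ (proj₁ (bounds (span U) (lastOf∈ a u′))))
                                                             (≈-reflexive (cong (x ∘ suc) (ℕP.suc-injective (len U))))))) ⟩
    (pow t (inv (a ∷ u′)) ⊗ pow t (suc k)) ⊗ (xDesFrom x 1 (a ∷ u′) ⊗ x (suc k))
      ≈⟨ interchange _ _ _ _ ⟩
    wt 1 (a ∷ u′) ⊗ (pow t (suc k) ⊗ x (suc k)) ∎
    where
    inv≡ : inv ((a ∷ u′) ++ lo ∷ []) ≡ inv (a ∷ u′) + suc k
    inv≡ = trans (inv-++ (a ∷ u′) (lo ∷ []))
             (cong (inv (a ∷ u′) +_) (trans (ℕP.+-identityʳ _)
               (trans (cross-all (a ∷ u′) (lo ∷ []) (λ { a∈ (here refl) → proj₁ (bounds (span U) a∈) }))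
                      (trans (ℕP.*-identityʳ _) (len U)))))

  prefixRanged-sum : ∀ lo k → sumL (map (wt 1) (prefixRanged lo (suc k))) ≈ prefixPoly k
  prefixRanged-sum lo zero    = ≈-trans (+-identityʳ _) (*-identityʳ _)
  prefixRanged-sum lo (suc k) = begin
    sumL (map (wt 1) (map (_∷ʳ (lo + suc k)) tops ++ map (_∷ʳ lo) bottoms))
      ≈⟨ sum-map-++ (wt 1) (map (_∷ʳ (lo + suc k)) tops) (map (_∷ʳ lo) bottoms) ⟩
    sumL (map (wt 1) (map (_∷ʳ (lo + suc k)) tops)) ⊕ sumL (map (wt 1) (map (_∷ʳ lo) bottoms))
      ≈⟨ +-cong (sum-map-∘ (wt 1) (_∷ʳ (lo + suc k)) tops) (sum-map-∘ (wt 1) (_∷ʳ lo) bottoms) ⟩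
    sumL (map (λ u → wt 1 (u ∷ʳ (lo + suc k))) tops) ⊕ sumL (map (λ u → wt 1 (u ∷ʳ lo)) bottoms)
      ≈⟨ +-cong (sum-cong _ (wt 1) tops (wt-∷ʳtop lo k _))
                (≈-trans (sum-cong _ (λ u → wt 1 u ⊗ c′) bottoms (wt-∷ʳbottom lo k _)) (sum-*ʳ (wt 1) c′ bottoms)) ⟩
    sumL (map (wt 1) tops) ⊕ sumL (map (wt 1) bottoms) ⊗ c′
      ≈⟨ +-cong (prefixRanged-sum lo k) (*-congʳ (prefixRanged-sum (suc lo) k)) ⟩
    prefixPoly k ⊕ prefixPoly k ⊗ c′
      ≈⟨ ≈-trans (+-congʳ (≈-sym (*-identityʳ _))) (≈-sym (distribˡ _ _ _)) ⟩
    prefixPoly (suc k) ∎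
    where
    tops    = prefixRanged lo (suc k)
    bottoms = prefixRanged (suc lo) (suc k)
    c′      = pow t (suc k) ⊗ x (suc k)

  -- Prepending the new minimum creates no inversion and no descent …
  wt-∷bottom : ∀ lo r p d → d ∈ suffixRanged (suc lo) (suc r) → wt p (lo ∷ d) ≈ wt (suc p) d
  wt-∷bottom lo r p d d∈ with suffixRanged-arrangement (suc lo) r d d∈
  wt-∷bottom lo r p (y ∷ d′) d∈ | D = begin
    pow t (countᵇ (_<ᵇ lo) (y ∷ d′) + inv (y ∷ d′)) ⊗ (descentAt y lo p ⊗ xDesFrom x (suc p) (y ∷ d′))
      ≈⟨ *-cong (≈-reflexive (cong (λ z → pow t (z + inv (y ∷ d′))) (countᵇ-none lo (y ∷ d′) (λ b∈ → ℕP.<⇒≤ (proj₁ (bounds (span D) b∈))))))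
                (*-congʳ (ascent p (ℕP.<⇒≤ (proj₁ (bounds (span D) (here refl)))))) ⟩
    pow t (inv (y ∷ d′)) ⊗ (1# ⊗ xDesFrom x (suc p) (y ∷ d′))
      ≈⟨ *-congˡ (*-identityˡ _) ⟩
    wt (suc p) (y ∷ d′) ∎

  -- … prepending the new maximum creates r+1 inversions and a descent at position p.
  wt-∷top : ∀ lo r p d → d ∈ suffixRanged lo (suc r) → wt p ((lo + suc r) ∷ d) ≈ (pow t (suc r) ⊗ x p) ⊗ wt (suc p) d
  wt-∷top lo r p d d∈ with suffixRanged-arrangement lo r d d∈
  wt-∷top lo r p (y ∷ d′) d∈ | D = begin
    pow t (countᵇ (_<ᵇ top) (y ∷ d′) + inv (y ∷ d′)) ⊗ (descentAt y top p ⊗ xDesFrom x (suc p) (y ∷ d′))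
      ≈⟨ *-cong (≈-trans (≈-reflexive (cong (λ z → pow t (z + inv (y ∷ d′)))
                             (trans (countᵇ-all top (y ∷ d′) (λ b∈ → proj₂ (bounds (span D) b∈))) (len D))))
                         (pow-+ (suc r) _))
                (*-congʳ (descent p (proj₂ (bounds (span D) (here refl))))) ⟩
    (pow t (suc r) ⊗ pow t (inv (y ∷ d′))) ⊗ (x p ⊗ xDesFrom x (suc p) (y ∷ d′))
      ≈⟨ interchange _ _ _ _ ⟩
    (pow t (suc r) ⊗ x p) ⊗ wt (suc p) (y ∷ d′) ∎
    where top = lo + suc r

  suffixRanged-sum : ∀ lo r p → sumL (map (wt p) (suffixRanged lo (suc r))) ≈ suffixPoly p r
  suffixRanged-sum lo zero    p = ≈-trans (+-identityʳ _) (*-identityʳ _)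
  suffixRanged-sum lo (suc r) p = begin
    sumL (map (wt p) (map (lo ∷_) bottoms ++ map ((lo + suc r) ∷_) tops))
      ≈⟨ sum-map-++ (wt p) (map (lo ∷_) bottoms) (map ((lo + suc r) ∷_) tops) ⟩
    sumL (map (wt p) (map (lo ∷_) bottoms)) ⊕ sumL (map (wt p) (map ((lo + suc r) ∷_) tops))
      ≈⟨ +-cong (sum-map-∘ (wt p) (lo ∷_) bottoms) (sum-map-∘ (wt p) ((lo + suc r) ∷_) tops) ⟩
    sumL (map (λ d → wt p (lo ∷ d)) bottoms) ⊕ sumL (map (λ d → wt p ((lo + suc r) ∷ d)) tops)
      ≈⟨ +-cong (sum-cong _ (wt (suc p)) bottoms (wt-∷bottom lo r p _))
                (≈-trans (sum-cong _ (λ d → c′ ⊗ wt (suc p) d) tops (wt-∷top lo r p _)) (sum-*ˡ (wt (suc p)) c′ tops)) ⟩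
    sumL (map (wt (suc p)) bottoms) ⊕ c′ ⊗ sumL (map (wt (suc p)) tops)
      ≈⟨ +-cong (suffixRanged-sum (suc lo) r (suc p)) (*-congˡ (suffixRanged-sum lo r (suc p))) ⟩
    suffixPoly (suc p) r ⊕ c′ ⊗ suffixPoly (suc p) r
      ≈⟨ ≈-trans (+-congʳ (≈-sym (*-identityˡ _))) (≈-sym (distribʳ _ _ _)) ⟩
    suffixPoly p (suc r) ∎
    where
    bottoms = suffixRanged (suc lo) (suc r)
    tops    = suffixRanged lo (suc r)
    c′      = pow t (suc r) ⊗ x p

  wt-splice : ∀ a u′ z y d′ →
    wt 1 ((a ∷ u′) ++ z ∷ y ∷ d′) ≈
      (pow t (cross (a ∷ u′) (z ∷ y ∷ d′) + countᵇ (_<ᵇ z) (y ∷ d′))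
         ⊗ (descentAt z (lastOf a u′) (suc (length u′)) ⊗ descentAt y z (suc (suc (length u′)))))
      ⊗ (wt 1 (a ∷ u′) ⊗ wt (suc (suc (suc (length u′)))) (y ∷ d′))
  wt-splice a u′ z y d′ = begin
    pow t (inv (u ++ z ∷ D)) ⊗ xDesFrom x 1 (u ++ z ∷ D)
      ≈⟨ *-cong (≈-trans (≈-reflexive (cong (pow t) inv≡)) (≈-trans (pow-+ (inv u) _) (*-congˡ (pow-+ J (inv D)))))
                (xDes-++ 1 a u′ z D) ⟩
    (pow t (inv u) ⊗ (pow t J ⊗ pow t (inv D))) ⊗ (xDesFrom x 1 u ⊗ (δz ⊗ (δy ⊗ xDesFrom x (3 + k) D)))
      ≈⟨ rearrange (pow t (inv u)) (pow t J) (pow t (inv D)) (xDesFrom x 1 u) δz δy (xDesFrom x (3 + k) D) ⟩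
    (pow t J ⊗ (δz ⊗ δy)) ⊗ (wt 1 u ⊗ wt (3 + k) D) ∎
    where
    u = a ∷ u′
    D = y ∷ d′
    k = length u′
    J = cross u (z ∷ D) + countᵇ (_<ᵇ z) D
    δz = descentAt z (lastOf a u′) (suc k)
    δy = descentAt y z (suc (suc k))
    inv≡ : inv (u ++ z ∷ D) ≡ inv u + (J + inv D)
    inv≡ = trans (inv-++ u (z ∷ D)) (cong (inv u +_) (sym (ℕP.+-assoc (cross u (z ∷ D)) _ _)))
    rearrange : ∀ a b c d e f g → (a ⊗ (b ⊗ c)) ⊗ (d ⊗ (e ⊗ (f ⊗ g))) ≈ (b ⊗ (e ⊗ f)) ⊗ ((a ⊗ d) ⊗ (c ⊗ g))
    rearrange a b c d e f g = prove 7 ((A · (B · C)) · (D′ · (E · (F · G)))) ((B · (E · F)) · ((A · D′) · (C · G)))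
                                (a ∷ᵛ b ∷ᵛ c ∷ᵛ d ∷ᵛ e ∷ᵛ f ∷ᵛ g ∷ᵛ []ᵛ)
      where
      A = var 0F ; B = var 1F ; C = var 2F ; D′ = var 3F ; E = var 4F ; F = var 5F ; G = var 6F

  -- Splicing 0 between u > d: (k+1)(r+2) crossing inversions and a descent at position k+1.
  wt-zeroSplice : ∀ a u′ y d′ → (∀ {v} → v ∈ a ∷ u′ → 0 < v) → (∀ {v w} → v ∈ a ∷ u′ → w ∈ y ∷ d′ → w < v) →
    wt 1 ((a ∷ u′) ++ 0 ∷ y ∷ d′) ≈
      (pow t (suc (length u′) * suc (suc (length d′))) ⊗ x (suc (length u′))) ⊗ (wt 1 (a ∷ u′) ⊗ wt (suc (suc (suc (length u′)))) (y ∷ d′))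
  wt-zeroSplice a u′ y d′ u>0 u>d = ≈-trans (wt-splice a u′ 0 y d′) (*-congʳ (*-cong (≈-reflexive (cong (pow t) J≡))
    (≈-trans (*-cong (descent _ (u>0 (lastOf∈ a u′))) (ascent {b = y} (suc (suc (length u′))) z≤n)) (*-identityʳ _))))
    where
    J≡ : cross (a ∷ u′) (0 ∷ y ∷ d′) + countᵇ (_<ᵇ 0) (y ∷ d′) ≡ suc (length u′) * suc (suc (length d′))
    J≡ = trans (cong₂ _+_ (cross-all (a ∷ u′) (0 ∷ y ∷ d′) (λ { v∈ (here refl) → u>0 v∈ ; v∈ (there w∈) → u>d v∈ w∈ }))
                          (countᵇ-none 0 (y ∷ d′) (λ _ → z≤n)))
               (ℕP.+-identityʳ _)

  -- Splicing N between u ≤ d below N: r+1 crossing inversions and a descent at position k+2.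
  wt-topSplice : ∀ N a u′ y d′ → (∀ {v} → v ∈ a ∷ u′ → v < N) → (∀ {v} → v ∈ y ∷ d′ → v < N) →
    (∀ {v w} → v ∈ a ∷ u′ → w ∈ y ∷ d′ → v ≤ w) →
    wt 1 ((a ∷ u′) ++ N ∷ y ∷ d′) ≈
      (pow t (suc (length d′)) ⊗ x (suc (suc (length u′)))) ⊗ (wt 1 (a ∷ u′) ⊗ wt (suc (suc (suc (length u′)))) (y ∷ d′))
  wt-topSplice N a u′ y d′ u<N d<N u≤d = ≈-trans (wt-splice a u′ N y d′) (*-congʳ (*-cong (≈-reflexive (cong (pow t) J≡))
    (≈-trans (*-cong (ascent _ (ℕP.<⇒≤ (u<N (lastOf∈ a u′)))) (descent _ (d<N (here refl)))) (*-identityˡ _))))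
    where
    J≡ : cross (a ∷ u′) (N ∷ y ∷ d′) + countᵇ (_<ᵇ N) (y ∷ d′) ≡ suc (length d′)
    J≡ = cong₂ _+_ (cross-none (a ∷ u′) (N ∷ y ∷ d′) (λ { v∈ (here refl) → ℕP.<⇒≤ (u<N v∈) ; v∈ (there w∈) → u≤d v∈ w∈ }))
                   (countᵇ-all N (y ∷ d′) d<N)

  sum-splices : ∀ z Us Ds c p → (∀ {u d} → u ∈ Us → d ∈ Ds → wt 1 (u ++ z ∷ d) ≈ c ⊗ (wt 1 u ⊗ wt p d)) →
    sumL (map (wt 1) (splices z Us Ds)) ≈ c ⊗ (sumL (map (wt 1) Us) ⊗ sumL (map (wt p) Ds))
  sum-splices z Us Ds c p factor = begin
    sumL (map (wt 1) (splices z Us Ds))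
      ≈⟨ sum-concatMap (wt 1) (λ u → map (λ d → u ++ z ∷ d) Ds) Us ⟩
    sumL (map (λ u → sumL (map (wt 1) (map (λ d → u ++ z ∷ d) Ds))) Us)
      ≈⟨ sum-cong _ (λ u → (c ⊗ wt 1 u) ⊗ sumL (map (wt p) Ds)) Us row ⟩
    sumL (map (λ u → (c ⊗ wt 1 u) ⊗ sumL (map (wt p) Ds)) Us)
      ≈⟨ ≈-trans (sum-*ʳ (λ u → c ⊗ wt 1 u) _ Us) (*-congʳ (sum-*ˡ (wt 1) c Us)) ⟩
    (c ⊗ sumL (map (wt 1) Us)) ⊗ sumL (map (wt p) Ds)
      ≈⟨ *-assoc _ _ _ ⟩
    c ⊗ (sumL (map (wt 1) Us) ⊗ sumL (map (wt p) Ds)) ∎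
    where
    row : ∀ {u} → u ∈ Us → sumL (map (wt 1) (map (λ d → u ++ z ∷ d) Ds)) ≈ (c ⊗ wt 1 u) ⊗ sumL (map (wt p) Ds)
    row {u} u∈ = ≈-trans (sum-map-∘ (wt 1) (λ d → u ++ z ∷ d) Ds)
      (≈-trans (sum-cong _ (λ d → (c ⊗ wt 1 u) ⊗ wt p d) Ds (λ d∈ → ≈-trans (factor u∈ d∈) (≈-sym (*-assoc _ _ _))))
               (sum-*ˡ (wt p) (c ⊗ wt 1 u) Ds))

  prefixPoly≈prodR : ∀ K → prodR 1 K (λ i → 1# ⊕ pow t i ⊗ x i) ≈ prefixPoly K
  prefixPoly≈prodR zero    = ≈-refl
  prefixPoly≈prodR (suc K) = begin
    prodL (map F (map suc (upTo (suc K))))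
      ≡⟨ cong (λ is → prodL (map F (map suc is))) (sym (LP.upTo-∷ʳ K)) ⟩
    prodL (map F (map suc (upTo K ∷ʳ K)))
      ≡⟨ cong prodL (trans (cong (map F) (LP.map-++ suc (upTo K) (K ∷ []))) (LP.map-++ F (map suc (upTo K)) (suc K ∷ []))) ⟩
    prodL (map F (map suc (upTo K)) ∷ʳ F (suc K))
      ≈⟨ prodL-∷ʳ (map F (map suc (upTo K))) (F (suc K)) ⟩
    prodL (map F (map suc (upTo K))) ⊗ F (suc K)
      ≈⟨ *-congʳ (prefixPoly≈prodR K) ⟩
    prefixPoly (suc K) ∎
    where
    F = λ i → 1# ⊕ pow t i ⊗ x i
    prodL-∷ʳ : ∀ as b → prodL (as ∷ʳ b) ≈ prodL as ⊗ b
    prodL-∷ʳ []       b = ≈-trans (*-identityʳ b) (≈-sym (*-identityˡ b))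
    prodL-∷ʳ (a ∷ as) b = ≈-trans (*-congˡ (prodL-∷ʳ as b)) (≈-sym (*-assoc _ _ _))

  suffixPoly≈prodR : ∀ n p K → p + K ≡ n → prodL (map (λ q → 1# ⊕ pow t (n ∸ q) ⊗ x q) (map (p +_) (upTo K))) ≈ suffixPoly p K
  suffixPoly≈prodR n p zero    _  = ≈-refl
  suffixPoly≈prodR n p (suc K) p+K≡n =
    ≈-trans (≈-reflexive (cong (prodL ∘ map F) (shift-upTo p K)))
      (*-cong (+-congˡ (*-cong (≈-reflexive (cong (pow t) (trans (cong (n ∸_) (ℕP.+-identityʳ p)) n∸p≡)))
                               (≈-reflexive (cong x (ℕP.+-identityʳ p)))))
              (suffixPoly≈prodR n (suc p) K (trans (sym (ℕP.+-suc p K)) p+K≡n)))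
    where
    F = λ q → 1# ⊕ pow t (n ∸ q) ⊗ x q
    n∸p≡ : n ∸ p ≡ suc K
    n∸p≡ = trans (cong (_∸ p) (sym p+K≡n)) (ℕP.m+n∸m≡n p (suc K))

  blockTerm : ℕ → ℕ → Carrier
  blockTerm n j = (pow t (j * (n ∸ j)) ⊗ x j ⊕ pow t (n ∸ j ∸ 1) ⊗ x (suc j))
                ⊗ prodR 1 (j ∸ 1) (λ i → 1# ⊕ pow t i ⊗ x i)
                ⊗ prodR (j + 2) (n ∸ 1) (λ i → 1# ⊕ pow t (n ∸ i) ⊗ x i)

  zeroBlock-sum : ∀ i r → sumL (map (wt 1) (splices 0 (prefixRanged (suc (suc r)) (suc i)) (suffixRanged 1 (suc r))))
    ≈ (pow t (suc i * suc (suc r)) ⊗ x (suc i)) ⊗ (prefixPoly i ⊗ suffixPoly (3 + i) r)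
  zeroBlock-sum i r = ≈-trans (sum-splices 0 _ _ _ (3 + i) factor)
                              (*-congˡ (*-cong (prefixRanged-sum (suc (suc r)) i) (suffixRanged-sum 1 r (3 + i))))
    where
    factor : ∀ {u d} → u ∈ prefixRanged (suc (suc r)) (suc i) → d ∈ suffixRanged 1 (suc r) →
      wt 1 (u ++ 0 ∷ d) ≈ (pow t (suc i * suc (suc r)) ⊗ x (suc i)) ⊗ (wt 1 u ⊗ wt (3 + i) d)
    factor {u} {d} u∈ d∈ with prefixRanged-arrangement (suc (suc r)) i u u∈ | suffixRanged-arrangement 1 r d d∈
    factor {a ∷ u′} {y ∷ d′} u∈ d∈ | U | D =
      ≈-trans (wt-zeroSplice a u′ y d′ (λ v∈ → ℕP.<-≤-trans (s≤s z≤n) (proj₁ (bounds (span U) v∈)))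
                                      (λ v∈ w∈ → ℕP.<-≤-trans (proj₂ (bounds (span D) w∈)) (proj₁ (bounds (span U) v∈))))
        (≈-reflexive (cong₂ (λ k l → (pow t (suc k * suc (suc l)) ⊗ x (suc k)) ⊗ (wt 1 (a ∷ u′) ⊗ wt (3 + k) (y ∷ d′)))
                            (ℕP.suc-injective (len U)) (ℕP.suc-injective (len D))))

  topBlock-sum : ∀ i r → sumL (map (wt 1) (splices (suc i + suc r) (prefixRanged 0 (suc i)) (suffixRanged (suc i) (suc r))))
    ≈ (pow t (suc r) ⊗ x (suc (suc i))) ⊗ (prefixPoly i ⊗ suffixPoly (3 + i) r)
  topBlock-sum i r = ≈-trans (sum-splices (suc i + suc r) _ _ _ (3 + i) factor)
                             (*-congˡ (*-cong (prefixRanged-sum 0 i) (suffixRanged-sum (suc i) r (3 + i))))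
    where
    factor : ∀ {u d} → u ∈ prefixRanged 0 (suc i) → d ∈ suffixRanged (suc i) (suc r) →
      wt 1 (u ++ (suc i + suc r) ∷ d) ≈ (pow t (suc r) ⊗ x (suc (suc i))) ⊗ (wt 1 u ⊗ wt (3 + i) d)
    factor {u} {d} u∈ d∈ with prefixRanged-arrangement 0 i u u∈ | suffixRanged-arrangement (suc i) r d d∈
    factor {a ∷ u′} {y ∷ d′} u∈ d∈ | U | D =
      ≈-trans (wt-topSplice (suc i + suc r) a u′ y d′
                 (λ v∈ → ℕP.<-≤-trans (proj₂ (bounds (span U) v∈)) (ℕP.m≤m+n (suc i) (suc r)))
                 (λ w∈ → proj₂ (bounds (span D) w∈))
                 (λ v∈ w∈ → ℕP.<⇒≤ (ℕP.<-≤-trans (proj₂ (bounds (span U) v∈)) (proj₁ (bounds (span D) w∈)))))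
        (≈-reflexive (cong₂ (λ k l → (pow t (suc l) ⊗ x (suc (suc k))) ⊗ (wt 1 (a ∷ u′) ⊗ wt (3 + k) (y ∷ d′)))
                            (ℕP.suc-injective (len U)) (ℕP.suc-injective (len D))))

  blocks-sum : ∀ i r → sumL (map (wt 1) (blocks (suc i + suc (suc r)) (suc i))) ≈ blockTerm (suc i + suc (suc r)) (suc i)
  blocks-sum i r = begin
    sumL (map (wt 1) (zeroBlock n (suc i) ++ topBlock n (suc i)))
      ≈⟨ sum-map-++ (wt 1) (zeroBlock n (suc i)) (topBlock n (suc i)) ⟩
    sumL (map (wt 1) (zeroBlock n (suc i))) ⊕ sumL (map (wt 1) (topBlock n (suc i)))
      ≈⟨ +-cong (≈-trans (≈-reflexive (cong (sumL ∘ map (wt 1)) (zeroBlock-at i r))) (zeroBlock-sum i r))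
                (≈-trans (≈-reflexive (cong (sumL ∘ map (wt 1)) (topBlock-at i r))) (topBlock-sum i r)) ⟩
    cZero ⊗ (prefixPoly i ⊗ suffixPoly (3 + i) r) ⊕ cTop ⊗ (prefixPoly i ⊗ suffixPoly (3 + i) r)
      ≈⟨ ≈-trans (≈-sym (distribʳ _ _ _)) (≈-sym (*-assoc _ _ _)) ⟩
    ((cZero ⊕ cTop) ⊗ prefixPoly i) ⊗ suffixPoly (3 + i) r
      ≈⟨ ≈-sym (*-cong (*-cong coefficients (prefixPoly≈prodR i)) suffix-product) ⟩
    blockTerm n (suc i) ∎
    where
    n = suc i + suc (suc r)
    cZero = pow t (suc i * suc (suc r)) ⊗ x (suc i)
    cTop  = pow t (suc r) ⊗ x (suc (suc i))
    coefficients : pow t (suc i * (n ∸ suc i)) ⊗ x (suc i) ⊕ pow t (n ∸ suc i ∸ 1) ⊗ x (suc (suc i)) ≈ cZero ⊕ cTop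
    coefficients = ≈-reflexive (cong (λ z → pow t (suc i * z) ⊗ x (suc i) ⊕ pow t (z ∸ 1) ⊗ x (suc (suc i)))
                                     (ℕP.m+n∸m≡n (suc i) (suc (suc r))))
    -- the second product of the summand runs over q = i+3, …, n-1
    suffix-product : prodR (suc i + 2) (n ∸ 1) (λ q → 1# ⊕ pow t (n ∸ q) ⊗ x q) ≈ suffixPoly (3 + i) r
    suffix-product = ≈-trans (suffixPoly≈prodR n (suc i + 2) K (trans (cong (suc i + 2 +_) K≡) (ℕP.+-assoc (suc i) 2 r)))
                             (≈-reflexive (cong₂ suffixPoly (ℕP.+-comm (suc i) 2) K≡))
      where
      K = suc (n ∸ 1) ∸ (suc i + 2)
      K≡ : K ≡ r
      K≡ = ℕP.[m+n]∸[m+o]≡n∸o i (suc (suc r)) 2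

  blocks-sum-at : ∀ m {j} → j ∈ range 1 m → sumL (map (wt 1) (blocks (suc (suc m)) j)) ≈ blockTerm (suc (suc m)) j
  blocks-sum-at m j∈ with block-index m _ j∈
  ... | i , r , refl , n≡ = subst (λ n → sumL (map (wt 1) (blocks n (suc i))) ≈ blockTerm n (suc i)) (sym n≡) (blocks-sum i r)

arcPerms↭arcList : ∀ m → arcPerms (suc (suc m)) ↭ arcList (suc (suc m))
arcPerms↭arcList m = ∼bag⇒↭ (unique∧set⇒bag arcPerms-unique (arcList-unique m) (mk⇔ arc⇒listed listed⇒arc))
  where
  n = suc (suc m)
  arcPerms-unique : Unique (arcPerms n)
  arcPerms-unique = Uniq.filter⁺ (λ w → T? (isPermᵇ n w ∧ isArcᵇ n w)) (words-unique n n)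
  arc⇒listed : ∀ {w} → w ∈ arcPerms n → w ∈ arcList n
  arc⇒listed {w} w∈ = Completeness.arcList-complete m w (to (arcPerms⇔ n w) w∈)
  listed⇒arc : ∀ {w} → w ∈ arcList n → w ∈ arcPerms n
  listed⇒arc {w} w∈ = from (arcPerms⇔ n w) (arcList-sound m w w∈)

theorem2p4 : {c ℓ : Level} (R : CommutativeSemiring c ℓ) (n : ℕ) → 2 ≤ n →
    (t : CommutativeSemiring.Carrier R) (x : ℕ → CommutativeSemiring.Carrier R) →
    CommutativeSemiring._≈_ R (Poly.arcLHS R n t x) (Poly.arcRHS R n t x)
theorem2p4 R (suc zero)    (s≤s ()) t x
theorem2p4 R (suc (suc m)) _        t x = begin
  sumL (map (wt 1) (arcPerms n))
    ≈⟨ sumL-↭ (PermP.map⁺ (wt 1) (arcPerms↭arcList m)) ⟩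
  sumL (map (wt 1) (arcList n))
    ≈⟨ sum-map-++ (wt 1) (prefixRanged 0 n) (concatMap (blocks n) (range 1 m)) ⟩
  sumL (map (wt 1) (prefixRanged 0 n)) ⊕ sumL (map (wt 1) (concatMap (blocks n) (range 1 m)))
    ≈⟨ +-cong (≈-trans (prefixRanged-sum 0 (suc m)) (≈-sym (prefixPoly≈prodR (suc m))))
              (≈-trans (sum-concatMap (wt 1) (blocks n) (range 1 m)) (sum-cong _ (blockTerm n) (range 1 m) (blocks-sum-at m))) ⟩
  Poly.arcRHS R n t x ∎
  where
  n = suc (suc m)
  open CommutativeSemiring R using (setoid; +-cong) renaming (_+_ to _⊕_; sym to ≈-sym; trans to ≈-trans)
  open Poly R using (sumL)
  open Weights R t x
  open import Relation.Binary.Reasoning.Setoid setoid
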